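{- In the setting described in the context, for every double coset $\mathcal{O}\in B(k)\backslash G(k)/K(k)$ one has $\mathcal{S}(\varphi(\mathcal{O}))=-\mathcal{S}(\mathcal{O})$; that is, the action of $\varphi$ on $2m$-matchings of $C_{2m+2n}$ coincides with the minus involution.
   Context: Let $k$ be a field with $\operatorname{char}k\ne2$, $m,n\ge0$, $N=m+n$, and $I=[-N,-1]\cup[1,N]$ with its natural order. Let $U$ be a $k$-vector space with basis $(e_j)_{j\in I}$ and symplectic form with $\langle e_{ -j},e_j\rangle=1$ for $j>0$ and $\langle e_i,e_j\rangle=0$ if $i+j\ne0$. Let $G=GL(U)$; for $i\in I$ let $U_i=\mathrm{span}\{e_j:j\le i\}$, and let $B\subset G$ be the stabilizer of this complete flag. Let $U^{2m}=\mathrm{span}\{e_j:|j|\le m\}$, $U^{2n}=\mathrm{span}\{e_j:|j|>m\}$, and $K\subset G$ the stabilizer of both ($K\cong GL(U^{2m})\times GL(U^{2n})$). Let $\varphi$ be the involution of $G$ defined by $\langle v,w\rangle=\langle gv,\varphi(g)w\rangle$ for all $v,w\in U$; $B,K$ are $\varphi$-stable, so $\varphi$ acts on $B(k)\backslash G(k)/K(k)$ by $B(k)gK(k)\mapsto B(k)\varphi(g)K(k)$. Let $C_{2N}$ be the graph with vertices $v_i,w_i$ ($i\in I$), an edge $v_iv_j$ for each $i\ne j$ and an edge $v_iw_i$ for each $i$. Labelling: for $g\in G(k)$, the flag $(U_i)_{i\in I}$ together with $A=gU^{2m}$, $A'=gU^{2n}$ (and inclusions) is a representation of the type $D_{2N+2}$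 quiver (chain of the $U_i$ in order, with $A$ and $A'$ mapping into $U$). By Gabriel's theorem and Krull–Schmidt, it decomposes uniquely up to isomorphism into indecomposables, each of one of three kinds: (a) dimension $1$ at $U_j$ for $j\ge i$, $0$ before, $1$ at $A$, $0$ at $A'$; (b) the same with $A,A'$ interchanged; (c) dimension $1$ at $U_l$ for $i\le l<j$, $2$ at $U_l$ for $l\ge j$, $0$ before $i$, and $1$ at each of $A$, $A'$ (where $i<j$). Let $\mathcal{S}(B(k)gK(k))$ be the set of edges $v_iw_i$ for summands of kind (a) and $v_iv_j$ for summands of kind (c). This is a $2m$-matching and $\mathcal{O}\mapsto\mathcal{S}(\mathcal{O})$ is a bijection from $B(k)\backslash G(k)/K(k)$ to the $2m$-matchings of $C_{2N}$. The minus involution $\mathcal{S}\mapsto-\mathcal{S}$ on matchings is induced by the graph automorphism $v_i\leftrightarrow v_{ -i}$, $w_i\leftrightarrow w_{ -i}$. -}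

module Defs where

open import Level using (Level; _⊔_)
open import Algebra.Bundles using (CommutativeRing)
open import Data.Nat as ℕ using (ℕ)
open import Data.List
open import Data.Unit using (⊤)
open import Data.Fin as F using (Fin; zero; suc; toℕ; opposite)
open import Data.Bool using (Bool; true; false; if_then_else_; _∧_; not)
open import Data.Product using (Σ; ∃; _×_; _,_)
open import Relation.Nullary using (¬_; does)

record IsField {c ℓ : Level} (R : CommutativeRing c ℓ) : Set (c ⊔ ℓ) where
  open CommutativeRing R hiding (zero)
  field
    1≉0     : ¬ (1# ≈ 0#)
    inverse : ∀ x → ¬ (x ≈ 0#) → Σ Carrier (λ y → x * y ≈ 1#)

-- Positions 0 .. 2N-1 of Fin (2N) encode the index set I = [-N,-1] ∪ [1,N]
-- in its natural order:  position p ↦ p - N  (p < N),  p - N + 1  (p ≥ N).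
-- Hence i ↦ -i corresponds to  opposite : Fin (2N) → Fin (2N).

-- Summands of the D_{2N+2} representation (kinds (a), (b), (c)).
data Kind (n : ℕ) : Set where
  kindA : Fin n → Kind n
  kindB : Fin n → Kind n
  kindC : (i j : Fin n) → i F.< j → Kind n

-- Edges of the graph C_{2N}: v_i w_i, and v_i v_j (stored with i < j).
data Edge (n : ℕ) : Set where
  vw : Fin n → Edge n
  vv : Fin n → Fin n → Edge n

-- minus involution induced by v_i ↔ v_{-i}, w_i ↔ w_{-i}
-- (the order of the endpoints is reversed to keep the smaller index first).
negEdge : ∀ {n} → Edge n → Edge n
negEdge (vw i)   = vw (opposite i)
negEdge (vv i j) = vv (opposite j) (opposite i)

edgeOf : ∀ {n} → Kind n → List (Edge n)
edgeOf (kindA i)     = vw i ∷ []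
edgeOf (kindB i)     = []
edgeOf (kindC i j _) = vv i j ∷ []

labelling : ∀ {n} → List (Kind n) → List (Edge n)
labelling = concatMap edgeOf

module LinAlg {c ℓ : Level} (R : CommutativeRing c ℓ) where
  open CommutativeRing R hiding (zero)

  V : ℕ → Set c
  V d = Fin d → Carrier

  Mat : ℕ → Set c
  Mat d = Fin d → Fin d → Carrier

  _≈V_ : ∀ {d} → V d → V d → Set ℓ
  u ≈V w = ∀ p → u p ≈ w p

  ∑ : ∀ {d} → (Fin d → Carrier) → Carrier
  ∑ {ℕ.zero}  f = 0#
  ∑ {ℕ.suc d} f = f zero + ∑ (λ p → f (suc p))

  0V : ∀ {d} → V d
  0V _ = 0#

  _+V_ : ∀ {d} → V d → V d → V d
  (u +V w) p = u p + w p

  _•_ : ∀ {d} → Carrier → V d → V d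
  (a • u) p = a * u p

  _·_ : ∀ {d} → Mat d → V d → V d
  (g · u) p = ∑ (λ q → g p q * u q)

  _⊗_ : ∀ {d} → Mat d → Mat d → Mat d
  (g ⊗ h) p q = ∑ (λ r → g p r * h r q)

  idM : ∀ {d} → Mat d
  idM p q = if does (p F.≟ q) then 1# else 0#

  _≈M_ : ∀ {d} → Mat d → Mat d → Set ℓ
  g ≈M h = ∀ p q → g p q ≈ h p q

  Invertible : ∀ {d} → Mat d → Set (c ⊔ ℓ)
  Invertible g = Σ (Mat _) (λ h → ((g ⊗ h) ≈M idM) × ((h ⊗ g) ≈M idM))

  e : ∀ {d} → Fin d → V d
  e q p = if does (p F.≟ q) then 1# else 0#

  -- the symplectic form: ⟨e_{-j}, e_j⟩ = 1, ⟨e_j, e_{-j}⟩ = -1 (j > 0), others 0.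
  -- In positions (size d = 2N): J p q = 1 if q = opposite p and p < N,
  --                             -1 if q = opposite p and p ≥ N.
  Jform : (N : ℕ) → Mat (N ℕ.+ N)
  Jform N p q =
    if does (q F.≟ opposite p)
    then (if does (toℕ p ℕ.<? N) then 1# else - 1#)
    else 0#

  ⟪_⟫⟨_,_⟩ : (N : ℕ) → V (N ℕ.+ N) → V (N ℕ.+ N) → Carrier
  ⟪ N ⟫⟨ u , w ⟩ = ∑ (λ p → ∑ (λ q → u p * (Jform N p q * w q)))

  lc : ∀ {d} → (ys : List (V d)) → (Fin (length ys) → Carrier) → V d
  lc []       a = 0V
  lc (y ∷ ys) a = (a zero • y) +V lc ys (λ t → a (suc t))

  InSpan : ∀ {d} → V d → List (V d) → Set (c ⊔ ℓ)
  InSpan x ys = Σ (Fin (length ys) → Carrier) (λ a → x ≈V lc ys a)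

  AllInSpan : ∀ {d} → List (V d) → List (V d) → Set (c ⊔ ℓ)
  AllInSpan []       ys = Level.Lift _ ⊤
  AllInSpan (x ∷ xs) ys = InSpan x ys × AllInSpan xs ys

  SameSpan : ∀ {d} → List (V d) → List (V d) → Set (c ⊔ ℓ)
  SameSpan xs ys = AllInSpan xs ys × AllInSpan ys xs

  LinIndep : ∀ {d} → List (V d) → Set (c ⊔ ℓ)
  LinIndep ys = ∀ a → lc ys a ≈V 0V → ∀ t → a t ≈ 0#

  -- A summand together with the images in U of the standard basis vectors of
  -- the corresponding indecomposable under an isomorphism onto the given
  -- representation. Standard models (top space k or k^2):
  --  (a) at i : vector x;  U_l = ⟨x⟩ for l ≥ i;  A = ⟨x⟩,  A' = 0
  --  (b) at i : vector x;  U_l = ⟨x⟩ for l ≥ i;  A = 0,    A' = ⟨x⟩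
  --  (c) at i<j : vectors x,y; U_l = ⟨x⟩ (i ≤ l < j), ⟨x,y⟩ (l ≥ j);
  --               A = ⟨y⟩, A' = ⟨x + y⟩
  data Piece (d : ℕ) : Set c where
    pieceA : Fin d → V d → Piece d
    pieceB : Fin d → V d → Piece d
    pieceC : (i j : Fin d) → i F.< j → V d → V d → Piece d

  kindOf : ∀ {d} → Piece d → Kind d
  kindOf (pieceA i x)         = kindA i
  kindOf (pieceB i x)         = kindB i
  kindOf (pieceC i j i<j x y) = kindC i j i<j

  vecsOf : ∀ {d} → Piece d → List (V d)
  vecsOf (pieceA i x)       = x ∷ []
  vecsOf (pieceB i x)       = x ∷ []
  vecsOf (pieceC i j _ x y) = x ∷ y ∷ []

  _≤ᵇ_ : ∀ {d} → Fin d → Fin d → Bool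
  i ≤ᵇ l = does (i F.≤? l)

  levelOf : ∀ {d} → Fin d → Piece d → List (V d)
  levelOf l (pieceA i x) = if i ≤ᵇ l then x ∷ [] else []
  levelOf l (pieceB i x) = if i ≤ᵇ l then x ∷ [] else []
  levelOf l (pieceC i j _ x y) =
    if j ≤ᵇ l then x ∷ y ∷ [] else (if i ≤ᵇ l then x ∷ [] else [])

  aOf : ∀ {d} → Piece d → List (V d)
  aOf (pieceA i x)       = x ∷ []
  aOf (pieceB i x)       = []
  aOf (pieceC i j _ x y) = y ∷ []

  a'Of : ∀ {d} → Piece d → List (V d)
  a'Of (pieceA i x)       = []
  a'Of (pieceB i x)       = x ∷ []
  a'Of (pieceC i j _ x y) = (x +V y) ∷ []

  -- positions of U^{2m} (|j| ≤ m), with N = m + n:  n ≤ p < n + 2m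
  inU2m : (m n : ℕ) → Fin ((m ℕ.+ n) ℕ.+ (m ℕ.+ n)) → Bool
  inU2m m n p = does (n ℕ.≤? toℕ p) ∧ does (toℕ p ℕ.<? n ℕ.+ (m ℕ.+ m))

  allPos : (d : ℕ) → List (Fin d)
  allPos d = allFin d

  filterPos : ∀ {d} → (Fin d → Bool) → List (Fin d)
  filterPos {d} P = filterᵇ P (allPos d)

  flagVecs : ∀ {d} → Fin d → List (V d)
  flagVecs l = map e (filterPos (λ q → q ≤ᵇ l))

  AVecs : (m n : ℕ) → Mat ((m ℕ.+ n) ℕ.+ (m ℕ.+ n)) → List (V ((m ℕ.+ n) ℕ.+ (m ℕ.+ n)))
  AVecs m n g = map (λ q → g · e q) (filterPos (inU2m m n))

  A'Vecs : (m n : ℕ) → Mat ((m ℕ.+ n) ℕ.+ (m ℕ.+ n)) → List (V ((m ℕ.+ n) ℕ.+ (m ℕ.+ n)))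
  A'Vecs m n g = map (λ q → g · e q) (filterPos (λ q → not (inU2m m n q)))

  -- A Krull–Schmidt decomposition of the D_{2N+2} representation
  -- ((U_i)_i, A = gU^{2m}, A' = gU^{2n}) into indecomposables of kinds
  -- (a),(b),(c): an isomorphism from the direct sum of the standard
  -- indecomposables, given by the images of their standard bases.
  IsDecomposition : (m n : ℕ) → Mat ((m ℕ.+ n) ℕ.+ (m ℕ.+ n))
                  → List (Piece ((m ℕ.+ n) ℕ.+ (m ℕ.+ n))) → Set (c ⊔ ℓ)
  IsDecomposition m n g ps =
    LinIndep (concatMap vecsOf ps)
    × (∀ l → SameSpan (concatMap (levelOf l) ps) (flagVecs l))
    × SameSpan (concatMap aOf ps) (AVecs m n g)
    × SameSpan (concatMap a'Of ps) (A'Vecs m n g)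

  𝒮 : ∀ {d} → List (Piece d) → List (Edge d)
  𝒮 ps = labelling (map kindOf ps)

module Submission where

-- Record a decomposition by the role of each index: the index of a summand of
-- kind (a) or (b), or the smaller index i or the larger index j of a summand of
-- kind (c).  As the decomposition is adapted to the flag, every index p carries
-- vectors of its summand in U_p ∖ U_{p-1}: one in A for kind (a), one in A′ for
-- kind (b), and both y ∈ A and x + y ∈ A′ at the larger index of kind (c).
-- Since ⟨gv, φ(g)w⟩ = ⟨v, w⟩, gU^{2m} ⊥ φ(g)U^{2n} and gU^{2n} ⊥ φ(g)U^{2m},
-- whereas vectors leading at opposite indices pair nontrivially.  So no index p
-- carries A for g while -p carries A′ for φ(g), or vice versa.  Counting then
-- matches the larger indices of (c)-summands for g with the negated smaller
-- indices of (c)-summands for φ(g); the same orthogonality bounds the partners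
-- of matched indices, and summing these bounds over all (c)-summands forces
-- equality.  Hence the role of -p for φ(g) is the dual of the role of p for g,
-- which is 𝒮(φ(𝒪)) = -𝒮(𝒪).

open import Defs
open import Level using (Level; _⊔_)
open import Algebra.Bundles using (CommutativeRing)
open import Function using (_∘_; const; _⇔_; mk⇔)
import Function.Properties.Equivalence as ⇔
open import Data.Bool using (Bool; true; false; T; not; _∧_; if_then_else_)
import Data.Bool.Properties as Boolₚ
open import Data.Unit using (tt)
open import Data.Empty using (⊥-elim)
open import Data.Sum using (_⊎_; inj₁; inj₂)
open import Data.Nat as ℕ using (ℕ; zero; suc; z≤n)
import Data.Nat.Properties as ℕₚ
open import Data.Nat.Solver using (module +-*-Solver)
open import Data.Fin as Fin using (Fin; toℕ; opposite)
import Data.Fin.Properties as Finₚ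
open import Data.Fin.Permutation using (permutation)
open import Data.Product using (∃; _×_; _,_; proj₁; proj₂; uncurry)
open import Data.List
  using (List; []; _∷_; _++_; map; length; lookup; filterᵇ; allFin; concatMap)
import Data.List.Properties as Listₚ
open import Data.List.Effectful using (module MonadProperties)
open import Data.List.Membership.Propositional using (_∈_; find)
open import Data.List.Membership.Propositional.Properties
  using (∈-map⁺; ∈-map⁻; ∈-allFin; ∈-filter⁺; ∈-filter⁻; ∈-lookup; ∈-concatMap⁺; ∈-concatMap⁻)
open import Data.List.Membership.Propositional.Properties.WithK using (unique∧set⇒bag)
open import Data.List.Relation.Unary.All as All using (All; []; _∷_)
import Data.List.Relation.Unary.All.Properties as AllP
open import Data.List.Relation.Unary.Any as Any using (here; there)
open import Data.List.Relation.Unary.AllPairs using ([]; _∷_)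
open import Data.List.Relation.Unary.Unique.Propositional using (Unique)
import Data.List.Relation.Unary.Unique.Propositional.Properties as Uniqueₚ
open import Data.List.Relation.Binary.BagAndSetEquality
  using (↭⇒∼bag; ∼bag⇒↭; concat-cong; map-cong)
open import Data.List.Relation.Binary.Permutation.Propositional
  using (_↭_; ↭-sym; module PermutationReasoning)
open import Data.List.Relation.Binary.Permutation.Propositional.Properties using (map⁺)
open import Relation.Nullary using (¬_; Dec; yes; no; does)
open import Relation.Nullary.Decidable using (T?; does-⇔)
open import Relation.Binary.Definitions using (tri<; tri≈; tri>)
import Relation.Binary.PropositionalEquality as ≡
open ≡ using (_≡_; _≢_)

module Combinatorics where

  open ≡ using (refl; sym; trans; cong; cong₂; subst; module ≡-Reasoning)
  open import Algebra.Properties.CommutativeMonoid.Sum ℕₚ.+-0-commutativeMonoid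
    using (sum; sum-permute; sum-cong-≗)

  sum-involution : ∀ {d} (π : Fin d → Fin d) → (∀ p → π (π p) ≡ p) →
                   (f : Fin d → ℕ) → sum (f ∘ π) ≡ sum f
  sum-involution π π² f = sym (sum-permute f (permutation π π π² π²))

  sum-mono-≤ : ∀ {d} {f g : Fin d → ℕ} → (∀ p → f p ℕ.≤ g p) → sum f ℕ.≤ sum g
  sum-mono-≤ {zero}  f≤g = z≤n
  sum-mono-≤ {suc d} f≤g = ℕₚ.+-mono-≤ (f≤g Fin.zero) (sum-mono-≤ (f≤g ∘ Fin.suc))

  sum-mono-≤-tight : ∀ {d} {f g : Fin d → ℕ} → (∀ p → f p ℕ.≤ g p) → sum g ℕ.≤ sum f →
                     ∀ p → f p ≡ g p
  sum-mono-≤-tight {suc d} {f} {g} f≤g Σg≤Σf Fin.zero =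
    ℕₚ.≤-antisym (f≤g Fin.zero)
      (ℕₚ.+-cancelʳ-≤ _ _ _ (ℕₚ.≤-trans (ℕₚ.+-monoʳ-≤ (g Fin.zero) (sum-mono-≤ (f≤g ∘ Fin.suc))) Σg≤Σf))
  sum-mono-≤-tight {suc d} {f} {g} f≤g Σg≤Σf (Fin.suc p) =
    sum-mono-≤-tight (f≤g ∘ Fin.suc)
      (ℕₚ.+-cancelˡ-≤ _ _ _ (ℕₚ.≤-trans (ℕₚ.+-monoˡ-≤ _ (f≤g Fin.zero)) Σg≤Σf)) p

  sumWhere : ∀ {d} → (Fin d → Bool) → (Fin d → ℕ) → ℕ
  sumWhere P f = sum (λ p → if P p then f p else 0)

  count : ∀ {d} → (Fin d → Bool) → ℕ
  count P = sumWhere P (const 1)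

  sumWhere-reindex : ∀ {d} (π : Fin d → Fin d) → (∀ p → π (π p) ≡ p) →
                     (Q : Fin d → Bool) (g : Fin d → ℕ) {P : Fin d → Bool} {f : Fin d → ℕ} →
                     (∀ p → P p ≡ Q (π p)) → (∀ p → f p ≡ g (π p)) →
                     sumWhere P f ≡ sumWhere Q g
  sumWhere-reindex π π² Q g P≡Q∘π f≡g∘π =
    trans (sum-cong-≗ (λ p → cong₂ (λ b x → if b then x else 0) (P≡Q∘π p) (f≡g∘π p)))
          (sum-involution π π² (λ q → if Q q then g q else 0))

  count-opposite : ∀ {d} (P : Fin d → Bool) → count (P ∘ opposite) ≡ count P
  count-opposite P =
    sumWhere-reindex opposite Finₚ.opposite-involutive P (const 1) (λ _ → refl) (λ _ → refl)

  indicator : Bool → ℕ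
  indicator b = if b then 1 else 0

  indicator-mono : ∀ x y → (T x → T y) → indicator x ℕ.≤ indicator y
  indicator-mono false _     _   = z≤n
  indicator-mono true  true  _   = ℕₚ.≤-refl
  indicator-mono true  false x⇒y = ⊥-elim (x⇒y tt)

  indicator-injective : ∀ x y → indicator x ≡ indicator y → x ≡ y
  indicator-injective false false _ = refl
  indicator-injective true  true  _ = refl

  count-mono : ∀ {d} {P Q : Fin d → Bool} → (∀ p → T (P p) → T (Q p)) → count P ℕ.≤ count Q
  count-mono {P = P} {Q} P⊆Q = sum-mono-≤ (λ p → indicator-mono (P p) (Q p) (P⊆Q p))

  sumWhere-mono-tight : ∀ {d} {P : Fin d → Bool} {f g : Fin d → ℕ} →
                        (∀ p → T (P p) → f p ℕ.≤ g p) → sumWhere P g ℕ.≤ sumWhere P f →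
                        ∀ p → T (P p) → f p ≡ g p
  sumWhere-mono-tight {P = P} {f} {g} f≤g Σg≤Σf p Pp = begin
    f p                     ≡⟨ if-T (P p) Pp ⟨
    (if P p then f p else 0) ≡⟨ sum-mono-≤-tight pointwise Σg≤Σf p ⟩
    (if P p then g p else 0) ≡⟨ if-T (P p) Pp ⟩
    g p                     ∎
    where
    open ≡-Reasoning
    if-T : ∀ {x y : ℕ} b → T b → (if b then x else y) ≡ x
    if-T true _ = refl
    pointwise : ∀ p → (if P p then f p else 0) ℕ.≤ (if P p then g p else 0)
    pointwise p with P p | f≤g p
    ... | true  | le = le tt
    ... | false | _  = z≤n

  count-mono-tight : ∀ {d} {P Q : Fin d → Bool} → (∀ p → T (P p) → T (Q p)) →
                     count Q ℕ.≤ count P → ∀ p → P p ≡ Q p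
  count-mono-tight {P = P} {Q} P⊆Q ΣQ≤ΣP p =
    indicator-injective (P p) (Q p)
      (sum-mono-≤-tight (λ q → indicator-mono (P q) (Q q) (P⊆Q q)) ΣQ≤ΣP p)

  -- roleCᵢ j: the smaller index of a summand of kind (c) whose larger index is
  -- j; roleCⱼ i: the larger index of one whose smaller index is i.
  data Role (d : ℕ) : Set where
    roleA roleB   : Role d
    roleCᵢ roleCⱼ : Fin d → Role d

  module _ {d : ℕ} where

    -- For kind (c) both y ∈ A and x + y ∈ A′ lead at j, so roleCⱼ is in both.
    inA inA′ : Role d → Bool
    inA roleA      = true
    inA roleB      = false
    inA (roleCᵢ _) = false
    inA (roleCⱼ _) = true
    inA′ roleA      = false
    inA′ roleB      = true
    inA′ (roleCᵢ _) = false
    inA′ (roleCⱼ _) = true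

    isCᵢ isCⱼ : Role d → Bool
    isCᵢ (roleCᵢ _) = true
    isCᵢ _          = false
    isCⱼ (roleCⱼ _) = true
    isCⱼ _          = false

    dual : Role d → Role d
    dual roleA      = roleA
    dual roleB      = roleB
    dual (roleCᵢ j) = roleCⱼ (opposite j)
    dual (roleCⱼ i) = roleCᵢ (opposite i)

    isCⱼ⇒inA : ∀ t → T (isCⱼ t) → T (inA t)
    isCⱼ⇒inA (roleCⱼ _) _ = tt

    isCⱼ⇒inA′ : ∀ t → T (isCⱼ t) → T (inA′ t)
    isCⱼ⇒inA′ (roleCⱼ _) _ = tt

    ¬inA∧¬inA′⇒isCᵢ : ∀ t → ¬ T (inA t) → ¬ T (inA′ t) → T (isCᵢ t)
    ¬inA∧¬inA′⇒isCᵢ roleA      ¬a _  = ¬a tt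
    ¬inA∧¬inA′⇒isCᵢ roleB      _  ¬b = ¬b tt
    ¬inA∧¬inA′⇒isCᵢ (roleCᵢ _) _  _  = tt
    ¬inA∧¬inA′⇒isCᵢ (roleCⱼ _) ¬a _  = ¬a tt

    ¬inA′∧¬isCᵢ⇒roleA : ∀ t → ¬ T (inA′ t) → ¬ T (isCᵢ t) → t ≡ roleA
    ¬inA′∧¬isCᵢ⇒roleA roleA      _  _  = refl
    ¬inA′∧¬isCᵢ⇒roleA roleB      ¬b _  = ⊥-elim (¬b tt)
    ¬inA′∧¬isCᵢ⇒roleA (roleCᵢ _) _  ¬c = ⊥-elim (¬c tt)
    ¬inA′∧¬isCᵢ⇒roleA (roleCⱼ _) ¬b _  = ⊥-elim (¬b tt)

    ¬inA∧¬isCᵢ⇒roleB : ∀ t → ¬ T (inA t) → ¬ T (isCᵢ t) → t ≡ roleB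
    ¬inA∧¬isCᵢ⇒roleB roleA      ¬a _  = ⊥-elim (¬a tt)
    ¬inA∧¬isCᵢ⇒roleB roleB      _  _  = refl
    ¬inA∧¬isCᵢ⇒roleB (roleCᵢ _) _  ¬c = ⊥-elim (¬c tt)
    ¬inA∧¬isCᵢ⇒roleB (roleCⱼ _) ¬a _  = ⊥-elim (¬a tt)

    partnerOf : Fin d → Role d → Fin d
    partnerOf _ (roleCᵢ j) = j
    partnerOf _ (roleCⱼ i) = i
    partnerOf p _          = p

    isCᵢ⇒≡roleCᵢ : ∀ p t → T (isCᵢ t) → t ≡ roleCᵢ (partnerOf p t)
    isCᵢ⇒≡roleCᵢ _ (roleCᵢ _) _ = refl

    isCⱼ⇒≡roleCⱼ : ∀ p t → T (isCⱼ t) → t ≡ roleCⱼ (partnerOf p t)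
    isCⱼ⇒≡roleCⱼ _ (roleCⱼ _) _ = refl

  record Shape (d : ℕ) : Set where
    field
      role       : Fin d → Role d
      Cᵢ-partner : ∀ {i j} → role i ≡ roleCᵢ j → role j ≡ roleCⱼ i
      Cⱼ-partner : ∀ {i j} → role j ≡ roleCⱼ i → role i ≡ roleCᵢ j

    partner : Fin d → Fin d
    partner p = partnerOf p (role p)

    partner-involutive : ∀ p → partner (partner p) ≡ p
    partner-involutive p with role p in eq
    ... | roleA    = cong (partnerOf p) eq
    ... | roleB    = cong (partnerOf p) eq
    ... | roleCᵢ j rewrite Cᵢ-partner eq = refl
    ... | roleCⱼ i rewrite Cⱼ-partner eq = refl

    isCᵢ≡isCⱼ∘partner : ∀ p → isCᵢ (role p) ≡ isCⱼ (role (partner p))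
    isCᵢ≡isCⱼ∘partner p with role p in eq
    ... | roleA    = sym (cong isCⱼ eq)
    ... | roleB    = sym (cong isCⱼ eq)
    ... | roleCᵢ j rewrite Cᵢ-partner eq = refl
    ... | roleCⱼ i rewrite Cⱼ-partner eq = refl

    partner-of-roleCⱼ : ∀ {i j} → role j ≡ roleCⱼ i → partner j ≡ i
    partner-of-roleCⱼ eq = cong (partnerOf _) eq

    isCᵢ⇒≡roleCᵢ-partner : ∀ {p} → T (isCᵢ (role p)) → role p ≡ roleCᵢ (partner p)
    isCᵢ⇒≡roleCᵢ-partner {p} = isCᵢ⇒≡roleCᵢ p (role p)

    isCⱼ⇒≡roleCⱼ-partner : ∀ {p} → T (isCⱼ (role p)) → role p ≡ roleCⱼ (partner p)
    isCⱼ⇒≡roleCⱼ-partner {p} = isCⱼ⇒≡roleCⱼ p (role p)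

    count-Cᵢ≡count-Cⱼ : count (isCᵢ ∘ role) ≡ count (isCⱼ ∘ role)
    count-Cᵢ≡count-Cⱼ = sumWhere-reindex partner partner-involutive (isCⱼ ∘ role) (const 1)
                          isCᵢ≡isCⱼ∘partner (λ _ → refl)

  isCⱼ-matches-opposite-isCᵢ :
    ∀ {d} (S S′ : Shape d) →
    (∀ p → T (isCⱼ (Shape.role S p)) → T (isCᵢ (Shape.role S′ (opposite p)))) →
    (∀ p → T (isCⱼ (Shape.role S′ p)) → T (isCᵢ (Shape.role S (opposite p)))) →
    ∀ p → isCⱼ (Shape.role S p) ≡ isCᵢ (Shape.role S′ (opposite p))
  isCⱼ-matches-opposite-isCᵢ S S′ S→S′ S′→S = count-mono-tight S→S′ (begin
    count (isCᵢ ∘ role S′ ∘ opposite) ≡⟨ count-opposite (isCᵢ ∘ role S′) ⟩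
    count (isCᵢ ∘ role S′)            ≡⟨ count-Cᵢ≡count-Cⱼ S′ ⟩
    count (isCⱼ ∘ role S′)            ≤⟨ count-mono S′→S ⟩
    count (isCᵢ ∘ role S ∘ opposite)  ≡⟨ count-opposite (isCᵢ ∘ role S) ⟩
    count (isCᵢ ∘ role S)             ≡⟨ count-Cᵢ≡count-Cⱼ S ⟩
    count (isCⱼ ∘ role S)             ∎)
    where
    open Shape
    open ℕₚ.≤-Reasoning

  module Duality {d} (S S′ : Shape d)
    (A⊥A′ : ∀ p → T (inA (Shape.role S p)) → ¬ T (inA′ (Shape.role S′ (opposite p))))
    (A′⊥A : ∀ p → T (inA′ (Shape.role S p)) → ¬ T (inA (Shape.role S′ (opposite p))))
    (Cᵢ-bound : ∀ {i j q} → Shape.role S i ≡ roleCᵢ j → Shape.role S′ (opposite j) ≡ roleCᵢ q →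
                toℕ (opposite i) ℕ.≤ toℕ q)
    where

    module D  = Shape S
    module D′ = Shape S′

    opposite² : ∀ (p : Fin d) → opposite (opposite p) ≡ p
    opposite² = Finₚ.opposite-involutive

    Cⱼ⇒opposite-Cᵢ : ∀ p → T (isCⱼ (D.role p)) → T (isCᵢ (D′.role (opposite p)))
    Cⱼ⇒opposite-Cᵢ p c = ¬inA∧¬inA′⇒isCᵢ _ (A′⊥A p (isCⱼ⇒inA′ _ c)) (A⊥A′ p (isCⱼ⇒inA _ c))

    Cⱼ′⇒opposite-Cᵢ : ∀ q → T (isCⱼ (D′.role q)) → T (isCᵢ (D.role (opposite q)))
    Cⱼ′⇒opposite-Cᵢ q c = ¬inA∧¬inA′⇒isCᵢ _
      (λ a  → A⊥A′ (opposite q) a  (at-q {inA′} (isCⱼ⇒inA′ _ c)))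
      (λ a′ → A′⊥A (opposite q) a′ (at-q {inA} (isCⱼ⇒inA _ c)))
      where
      at-q : ∀ {P : Role d → Bool} → T (P (D′.role q)) → T (P (D′.role (opposite (opposite q))))
      at-q {P} = subst (T ∘ P ∘ D′.role) (sym (opposite² q))

    Cⱼ≡opposite-Cᵢ : ∀ p → isCⱼ (D.role p) ≡ isCᵢ (D′.role (opposite p))
    Cⱼ≡opposite-Cᵢ = isCⱼ-matches-opposite-isCᵢ S S′ Cⱼ⇒opposite-Cᵢ Cⱼ′⇒opposite-Cᵢ

    Cⱼ′≡opposite-Cᵢ : ∀ q → isCⱼ (D′.role q) ≡ isCᵢ (D.role (opposite q))
    Cⱼ′≡opposite-Cᵢ = isCⱼ-matches-opposite-isCᵢ S′ S Cⱼ′⇒opposite-Cᵢ Cⱼ⇒opposite-Cᵢ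

    -- Summing the bound of Cᵢ-bound over all (c)-summands of D gives equal
    -- totals on both sides, so the bound is attained everywhere.
    partner-opposite : ∀ p → T (isCⱼ (D.role p)) → D′.partner (opposite p) ≡ opposite (D.partner p)
    partner-opposite p c = sym (Finₚ.toℕ-injective (sumWhere-mono-tight bound total≤ p c))
      where
      lower upper : Fin d → ℕ
      lower p = toℕ (opposite (D.partner p))
      upper p = toℕ (D′.partner (opposite p))

      bound : ∀ p → T (isCⱼ (D.role p)) → lower p ℕ.≤ upper p
      bound p c = Cᵢ-bound (D.Cⱼ-partner (D.isCⱼ⇒≡roleCⱼ-partner c))
                           (D′.isCᵢ⇒≡roleCᵢ-partner (Cⱼ⇒opposite-Cᵢ p c))

      total≤ : sumWhere (isCⱼ ∘ D.role) upper ℕ.≤ sumWhere (isCⱼ ∘ D.role) lower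
      total≤ = ℕₚ.≤-reflexive (begin
        sumWhere (isCⱼ ∘ D.role) upper
          ≡⟨ sumWhere-reindex opposite opposite² (isCᵢ ∘ D′.role) (toℕ ∘ D′.partner)
               Cⱼ≡opposite-Cᵢ (λ _ → refl) ⟩
        sumWhere (isCᵢ ∘ D′.role) (toℕ ∘ D′.partner)
          ≡⟨ sumWhere-reindex D′.partner D′.partner-involutive (isCⱼ ∘ D′.role) toℕ
               D′.isCᵢ≡isCⱼ∘partner (λ _ → refl) ⟩
        sumWhere (isCⱼ ∘ D′.role) toℕ
          ≡⟨ sumWhere-reindex opposite opposite² (isCᵢ ∘ D.role) (toℕ ∘ opposite)
               Cⱼ′≡opposite-Cᵢ (cong toℕ ∘ sym ∘ opposite²) ⟩
        sumWhere (isCᵢ ∘ D.role) (toℕ ∘ opposite)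
          ≡⟨ sumWhere-reindex D.partner D.partner-involutive (isCⱼ ∘ D.role) lower D.isCᵢ≡isCⱼ∘partner
               (cong (toℕ ∘ opposite) ∘ sym ∘ D.partner-involutive) ⟩
        sumWhere (isCⱼ ∘ D.role) lower ∎)
        where open ≡-Reasoning

    Cⱼ-dual : ∀ {p i} → D.role p ≡ roleCⱼ i → D′.role (opposite p) ≡ roleCᵢ (opposite i)
    Cⱼ-dual {p} {i} eq = begin
      D′.role (opposite p)             ≡⟨ D′.isCᵢ⇒≡roleCᵢ-partner (Cⱼ⇒opposite-Cᵢ p c) ⟩
      roleCᵢ (D′.partner (opposite p)) ≡⟨ cong roleCᵢ (partner-opposite p c) ⟩
      roleCᵢ (opposite (D.partner p))  ≡⟨ cong (roleCᵢ ∘ opposite) (D.partner-of-roleCⱼ eq) ⟩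
      roleCᵢ (opposite i)              ∎
      where
      open ≡-Reasoning
      c : T (isCⱼ (D.role p))
      c = subst (T ∘ isCⱼ) (sym eq) tt

    role-dual : ∀ p → D′.role (opposite p) ≡ dual (D.role p)
    role-dual p with D.role p in eq | A⊥A′ p | A′⊥A p | Cⱼ≡opposite-Cᵢ p
    ... | roleA    | a⊥ | _   | c≡ = ¬inA′∧¬isCᵢ⇒roleA _ (a⊥ tt) (subst T (sym c≡))
    ... | roleB    | _  | a′⊥ | c≡ = ¬inA∧¬isCᵢ⇒roleB _ (a′⊥ tt) (subst T (sym c≡))
    ... | roleCⱼ i | _  | _   | _  = Cⱼ-dual eq
    ... | roleCᵢ j | _  | _   | _  = D′.Cᵢ-partner (Cⱼ-dual (D.Cᵢ-partner eq))

  unique-key : ∀ {A B : Set} {xs : List (A × B)} → Unique (map proj₁ xs) →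
               ∀ {a b b′} → (a , b) ∈ xs → (a , b′) ∈ xs → b ≡ b′
  unique-key (_  ∷ _) (here refl) (here refl) = refl
  unique-key (a∉ ∷ _) (here refl) (there m′)  = ⊥-elim (All.lookup a∉ (∈-map⁺ proj₁ m′) refl)
  unique-key (a∉ ∷ _) (there m)   (here refl) = ⊥-elim (All.lookup a∉ (∈-map⁺ proj₁ m) refl)
  unique-key (_  ∷ u) (there m)   (there m′)  = unique-key u m m′

  ↭-of-same-unique-members : ∀ {A : Set} {xs ys : List A} → Unique xs → Unique ys →
                             (∀ {x} → x ∈ xs → x ∈ ys) → (∀ {x} → x ∈ ys → x ∈ xs) → xs ↭ ys
  ↭-of-same-unique-members u u′ to from = ∼bag⇒↭ (unique∧set⇒bag u u′ (mk⇔ to from))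

  concatMap-↭ : ∀ {A B : Set} (f : A → List B) {xs ys} → xs ↭ ys → concatMap f xs ↭ concatMap f ys
  concatMap-↭ f xs↭ys = ∼bag⇒↭ (concat-cong (map-cong (λ _ → refl) (↭⇒∼bag xs↭ys)))

  map-opposite-↭ : ∀ d → map opposite (allFin d) ↭ allFin d
  map-opposite-↭ d = ↭-of-same-unique-members
    (Uniqueₚ.map⁺ opposite-injective (Uniqueₚ.allFin⁺ d)) (Uniqueₚ.allFin⁺ d)
    (λ {p} _ → ∈-allFin p)
    (λ {p} _ → subst (_∈ map opposite (allFin d)) (Finₚ.opposite-involutive p)
                     (∈-map⁺ opposite (∈-allFin (opposite p))))
    where
    opposite-injective : ∀ {p q : Fin d} → opposite p ≡ opposite q → p ≡ q
    opposite-injective {p} {q} eq =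
      trans (sym (Finₚ.opposite-involutive p)) (trans (cong opposite eq) (Finₚ.opposite-involutive q))

  module FunctionalList {d} {B : Set} (rs : List (Fin d × B))
    (keys-unique : Unique (map proj₁ rs)) (keys-total : ∀ p → p ∈ map proj₁ rs) where

    opaque
      value : Fin d → B
      value p = proj₂ (proj₁ (∈-map⁻ proj₁ (keys-total p)))

      value-∈ : ∀ p → (p , value p) ∈ rs
      value-∈ p with ∈-map⁻ proj₁ (keys-total p)
      ... | _ , m , refl = m

    ∈⇒value : ∀ {p b} → (p , b) ∈ rs → value p ≡ b
    ∈⇒value m = unique-key keys-unique (value-∈ _) m

    graph : List (Fin d × B)
    graph = map (λ p → p , value p) (allFin d)

    ↭-graph : rs ↭ graph
    ↭-graph = ↭-of-same-unique-members
      (Uniqueₚ.map⁻ keys-unique) (Uniqueₚ.map⁺ (cong proj₁) (Uniqueₚ.allFin⁺ d))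
      (λ {(p , b)} m → subst (λ b → (p , b) ∈ graph) (∈⇒value m) (∈-map⁺ _ (∈-allFin p)))
      (λ m → let p , _ , eq = ∈-map⁻ _ m in subst (_∈ rs) (sym eq) (value-∈ p))

  module _ {d : ℕ} where

    kindRoles : Kind d → List (Fin d × Role d)
    kindRoles (kindA i)     = (i , roleA) ∷ []
    kindRoles (kindB i)     = (i , roleB) ∷ []
    kindRoles (kindC i j _) = (i , roleCᵢ j) ∷ (j , roleCⱼ i) ∷ []

    roleCᵢ∈⇒roleCⱼ∈ : ∀ κ {i j} → (i , roleCᵢ j) ∈ kindRoles κ → (j , roleCⱼ i) ∈ kindRoles κ
    roleCᵢ∈⇒roleCⱼ∈ (kindA _)     (here ())
    roleCᵢ∈⇒roleCⱼ∈ (kindA _)     (there ())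
    roleCᵢ∈⇒roleCⱼ∈ (kindB _)     (here ())
    roleCᵢ∈⇒roleCⱼ∈ (kindB _)     (there ())
    roleCᵢ∈⇒roleCⱼ∈ (kindC _ _ _) (here refl)         = there (here refl)
    roleCᵢ∈⇒roleCⱼ∈ (kindC _ _ _) (there (here ()))
    roleCᵢ∈⇒roleCⱼ∈ (kindC _ _ _) (there (there ()))

    roleCⱼ∈⇒roleCᵢ∈ : ∀ κ {i j} → (j , roleCⱼ i) ∈ kindRoles κ → (i , roleCᵢ j) ∈ kindRoles κ
    roleCⱼ∈⇒roleCᵢ∈ (kindA _)     (here ())
    roleCⱼ∈⇒roleCᵢ∈ (kindA _)     (there ())
    roleCⱼ∈⇒roleCᵢ∈ (kindB _)     (here ())
    roleCⱼ∈⇒roleCᵢ∈ (kindB _)     (there ())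
    roleCⱼ∈⇒roleCᵢ∈ (kindC _ _ _) (here ())
    roleCⱼ∈⇒roleCᵢ∈ (kindC _ _ _) (there (here refl)) = here refl
    roleCⱼ∈⇒roleCᵢ∈ (kindC _ _ _) (there (there ()))

    edgeᵢ edgeⱼ : Fin d → Role d → List (Edge d)
    edgeᵢ p roleA      = vw p ∷ []
    edgeᵢ p (roleCᵢ j) = vv p j ∷ []
    edgeᵢ _ _          = []
    edgeⱼ p roleA      = vw p ∷ []
    edgeⱼ p (roleCⱼ i) = vv i p ∷ []
    edgeⱼ _ _          = []

    edgeOf≡edgeᵢ : ∀ κ → edgeOf κ ≡ concatMap (uncurry edgeᵢ) (kindRoles κ)
    edgeOf≡edgeᵢ (kindA _)     = refl
    edgeOf≡edgeᵢ (kindB _)     = refl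
    edgeOf≡edgeᵢ (kindC _ _ _) = refl

    edgeOf≡edgeⱼ : ∀ κ → edgeOf κ ≡ concatMap (uncurry edgeⱼ) (kindRoles κ)
    edgeOf≡edgeⱼ (kindA _)     = refl
    edgeOf≡edgeⱼ (kindB _)     = refl
    edgeOf≡edgeⱼ (kindC _ _ _) = refl

    edgeᵢ-dual : ∀ p t → edgeᵢ (opposite p) (dual t) ≡ map negEdge (edgeⱼ p t)
    edgeᵢ-dual p roleA      = refl
    edgeᵢ-dual p roleB      = refl
    edgeᵢ-dual p (roleCᵢ _) = refl
    edgeᵢ-dual p (roleCⱼ _) = refl

  module KindShape {d} (K : List (Kind d))
    (unique : Unique (map proj₁ (concatMap kindRoles K)))
    (total : ∀ p → p ∈ map proj₁ (concatMap kindRoles K)) where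

    open FunctionalList (concatMap kindRoles K) unique total public
      renaming (value to role; value-∈ to role-∈; ∈⇒value to ∈⇒role)

    shape : Shape d
    shape = record
      { role       = role
      ; Cᵢ-partner = λ eq → ∈⇒role (transfer (λ κ → roleCᵢ∈⇒roleCⱼ∈ κ) (at eq))
      ; Cⱼ-partner = λ eq → ∈⇒role (transfer (λ κ → roleCⱼ∈⇒roleCᵢ∈ κ) (at eq))
      }
      where
      at : ∀ {p t} → role p ≡ t → (p , t) ∈ concatMap kindRoles K
      at {p} eq = subst (λ t → (p , t) ∈ concatMap kindRoles K) eq (role-∈ p)
      transfer : ∀ {x y} → (∀ κ → x ∈ kindRoles κ → y ∈ kindRoles κ) →
                 x ∈ concatMap kindRoles K → y ∈ concatMap kindRoles K
      transfer x⇒y m = ∈-concatMap⁺ kindRoles (Any.map (λ {κ} → x⇒y κ) (∈-concatMap⁻ kindRoles {xs = K} m))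

    labelling-by : (edge : Fin d → Role d → List (Edge d)) →
                   (∀ κ → edgeOf κ ≡ concatMap (uncurry edge) (kindRoles κ)) →
                   labelling K ↭ concatMap (λ p → edge p (role p)) (allFin d)
    labelling-by edge edgeOf≡ = begin
      labelling K                                          ≡⟨ Listₚ.concatMap-cong edgeOf≡ K ⟩
      concatMap (concatMap (uncurry edge) ∘ kindRoles) K   ≡⟨ MonadProperties.associative K kindRoles (uncurry edge) ⟩
      concatMap (uncurry edge) (concatMap kindRoles K)     ↭⟨ concatMap-↭ (uncurry edge) ↭-graph ⟩
      concatMap (uncurry edge) graph                       ≡⟨ Listₚ.concatMap-map (uncurry edge) _ (allFin d) ⟩
      concatMap (λ p → edge p (role p)) (allFin d)         ∎
      where open PermutationReasoning

  labelling-dual : ∀ {d} (ρ ρ′ : Fin d → Role d) → (∀ p → ρ′ (opposite p) ≡ dual (ρ p)) →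
                   concatMap (λ q → edgeᵢ q (ρ′ q)) (allFin d) ↭
                   map negEdge (concatMap (λ p → edgeⱼ p (ρ p)) (allFin d))
  labelling-dual {d} ρ ρ′ ρ′-dual = begin
    concatMap (λ q → edgeᵢ q (ρ′ q)) (allFin d)
      ↭⟨ concatMap-↭ _ (↭-sym (map-opposite-↭ d)) ⟩
    concatMap (λ q → edgeᵢ q (ρ′ q)) (map opposite (allFin d))
      ≡⟨ Listₚ.concatMap-map _ opposite (allFin d) ⟩
    concatMap (λ p → edgeᵢ (opposite p) (ρ′ (opposite p))) (allFin d)
      ≡⟨ Listₚ.concatMap-cong (λ p → trans (cong (edgeᵢ (opposite p)) (ρ′-dual p)) (edgeᵢ-dual p (ρ p))) (allFin d) ⟩
    concatMap (λ p → map negEdge (edgeⱼ p (ρ p))) (allFin d)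
      ≡⟨ Listₚ.map-concatMap negEdge _ (allFin d) ⟨
    map negEdge (concatMap (λ p → edgeⱼ p (ρ p)) (allFin d)) ∎
    where open PermutationReasoning

open Combinatorics

T-does : ∀ {a} {A : Set a} (a? : Dec A) → A → T (does a?)
T-does (yes _) _ = tt
T-does (no ¬a) a = ¬a a

T-does⁻¹ : ∀ {a} {A : Set a} (a? : Dec A) → T (does a?) → A
T-does⁻¹ (yes a) _ = a

opposite-< : ∀ {d} {p q : Fin d} → p Fin.< q → opposite q Fin.< opposite p
opposite-< {p = p} {q} p<q
  rewrite Finₚ.opposite-prop p | Finₚ.opposite-prop q = ℕₚ.∸-monoʳ-< (ℕ.s≤s p<q) (Finₚ.toℕ<n q)

T-not-T : ∀ {b} → T (not b) → ¬ T b
T-not-T {true} () _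

≤-complement : ∀ {a b k p} → k ℕ.+ suc p ≡ a ℕ.+ b → b ℕ.≤ k ⇔ p ℕ.< a
≤-complement {a} {b} {k} {p} eq = mk⇔
  (λ b≤k → ℕₚ.+-cancelʳ-≤ b (suc p) a
             (ℕₚ.≤-trans (ℕₚ.+-monoʳ-≤ (suc p) b≤k) (ℕₚ.≤-reflexive (≡.trans (ℕₚ.+-comm (suc p) k) eq))))
  (λ p<a → ℕₚ.+-cancelʳ-≤ a b k
             (ℕₚ.≤-trans (ℕₚ.≤-reflexive (≡.trans (ℕₚ.+-comm b a) (≡.sym eq))) (ℕₚ.+-monoʳ-≤ k p<a)))

All-concatMap-lookup : ∀ {a b q} {A : Set a} {B : Set b} {Q : B → Set q} (f : A → List B) {xs x} →
                       All Q (concatMap f xs) → x ∈ xs → All Q (f x)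
All-concatMap-lookup f all x∈ = All.lookup (AllP.map⁻ (AllP.concat⁻ all)) x∈

module Linear {c ℓ} (R : CommutativeRing c ℓ) (isField : IsField R) where

  open CommutativeRing R hiding (zero)
  open IsField isField
  open LinAlg R
  open import Algebra.Properties.Semiring.Sum semiring
    using (sum; sum-cong-≋; ∑-distrib-+; *-distribˡ-sum; sum-replicate-zero)
  open import Algebra.Properties.Ring ring using (-1*x≈-x; -‿distribˡ-*)
  open import Algebra.Properties.CommutativeSemigroup +-commutativeSemigroup using (interchange)
  open import Algebra.Properties.CommutativeSemigroup *-commutativeSemigroup using (x∙yz≈y∙xz)
  open import Algebra.Properties.Group +-group using (x∙y⁻¹≈ε⇒x≈y)
  open import Relation.Binary.Reasoning.Setoid setoid

  x*y≉0 : ∀ {x y} → ¬ x ≈ 0# → ¬ y ≈ 0# → ¬ x * y ≈ 0#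
  x*y≉0 {x} {y} x≉0 y≉0 xy≈0 = y≉0 (begin
    y                ≈⟨ *-identityˡ y ⟨
    1# * y           ≈⟨ *-congʳ x*x⁻¹≈1 ⟨
    (x * x⁻¹) * y    ≈⟨ *-congʳ (*-comm x x⁻¹) ⟩
    (x⁻¹ * x) * y    ≈⟨ *-assoc x⁻¹ x y ⟩
    x⁻¹ * (x * y)    ≈⟨ *-congˡ xy≈0 ⟩
    x⁻¹ * 0#         ≈⟨ zeroʳ x⁻¹ ⟩
    0#               ∎)
    where
    x⁻¹ = proj₁ (inverse x x≉0)
    x*x⁻¹≈1 = proj₂ (inverse x x≉0)

  -1≉0 : ¬ - 1# ≈ 0#
  -1≉0 -1≈0 = 1≉0 (begin
    1#         ≈⟨ +-identityʳ 1# ⟨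
    1# + 0#    ≈⟨ +-congˡ -1≈0 ⟨
    1# - 1#    ≈⟨ -‿inverseʳ 1# ⟩
    0#         ∎)

  ∑≡sum : ∀ {d} (f : Fin d → Carrier) → ∑ f ≡ sum f
  ∑≡sum {zero}  f = ≡.refl
  ∑≡sum {suc d} f = ≡.cong (f Fin.zero +_) (∑≡sum (f ∘ Fin.suc))

  sum-zero : ∀ {d} {f : Fin d → Carrier} → (∀ p → f p ≈ 0#) → sum f ≈ 0#
  sum-zero {d} f≈0 = trans (sum-cong-≋ f≈0) (sum-replicate-zero d)

  sum-single : ∀ {d} {f : Fin d → Carrier} p₀ → (∀ p → p ≢ p₀ → f p ≈ 0#) → sum f ≈ f p₀
  sum-single Fin.zero f≈0 =
    trans (+-congˡ (sum-zero (λ p → f≈0 (Fin.suc p) λ ()))) (+-identityʳ _)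
  sum-single (Fin.suc p₀) f≈0 =
    trans (+-congʳ (f≈0 Fin.zero λ ()))
          (trans (+-identityˡ _) (sum-single p₀ (λ p p≢p₀ → f≈0 (Fin.suc p) (p≢p₀ ∘ Finₚ.suc-injective))))

  e-diag : ∀ {d} (p : Fin d) → e p p ≡ 1#
  e-diag p with p Fin.≟ p
  ... | yes _   = ≡.refl
  ... | no p≢p = ⊥-elim (p≢p ≡.refl)

  e-off : ∀ {d} {p q : Fin d} → p ≢ q → e q p ≡ 0#
  e-off {p = p} {q} p≢q with p Fin.≟ q
  ... | yes p≡q = ⊥-elim (p≢q p≡q)
  ... | no _    = ≡.refl

  coordinates : ∀ {d} (w : V d) → w ≈V (λ p → sum (λ q → w q * e q p))
  coordinates w p = sym (trans (sum-single p off) (trans (*-congˡ (reflexive (e-diag p))) (*-identityʳ _)))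
    where
    off : ∀ q → q ≢ p → w q * e q p ≈ 0#
    off q q≢p = trans (*-congˡ (reflexive (e-off (q≢p ∘ ≡.sym)))) (zeroʳ _)

  lc-cong : ∀ {d} (ys : List (V d)) {a b} → (∀ t → a t ≈ b t) → lc ys a ≈V lc ys b
  lc-cong []       a≈b p = refl
  lc-cong (y ∷ ys) a≈b p = +-cong (*-congʳ (a≈b Fin.zero)) (lc-cong ys (a≈b ∘ Fin.suc) p)

  lc-zero : ∀ {d} (ys : List (V d)) {a} → (∀ t → a t ≈ 0#) → lc ys a ≈V 0V
  lc-zero []       a≈0 p = refl
  lc-zero (y ∷ ys) a≈0 p =
    trans (+-cong (trans (*-congʳ (a≈0 Fin.zero)) (zeroˡ _)) (lc-zero ys (a≈0 ∘ Fin.suc) p)) (+-identityʳ 0#)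

  lc-+ : ∀ {d} (ys : List (V d)) a b → lc ys (λ t → a t + b t) ≈V (lc ys a +V lc ys b)
  lc-+ []       a b p = sym (+-identityʳ 0#)
  lc-+ (y ∷ ys) a b p =
    trans (+-cong (distribʳ (y p) _ _) (lc-+ ys (a ∘ Fin.suc) (b ∘ Fin.suc) p)) (interchange _ _ _ _)

  lc-* : ∀ {d} (ys : List (V d)) k a → lc ys (λ t → k * a t) ≈V (k • lc ys a)
  lc-* []       k a p = sym (zeroʳ k)
  lc-* (y ∷ ys) k a p =
    trans (+-cong (*-assoc k _ _) (lc-* ys k (a ∘ Fin.suc) p)) (sym (distribˡ k _ _))

  lc-vanishing : ∀ {d} (ys : List (V d)) a q → (∀ t → a t ≈ 0# ⊎ lookup ys t q ≈ 0#) → lc ys a q ≈ 0#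
  lc-vanishing []       a q _ = refl
  lc-vanishing (y ∷ ys) a q vanish =
    trans (+-cong head-vanishes (lc-vanishing ys (a ∘ Fin.suc) q (vanish ∘ Fin.suc))) (+-identityʳ 0#)
    where
    head-vanishes : a Fin.zero * y q ≈ 0#
    head-vanishes with vanish Fin.zero
    ... | inj₁ a₀≈0 = trans (*-congʳ a₀≈0) (zeroˡ _)
    ... | inj₂ y≈0  = trans (*-congˡ y≈0) (zeroʳ _)

  lc-injective : ∀ {d} (ys : List (V d)) → LinIndep ys →
                 ∀ {a b} → lc ys a ≈V lc ys b → ∀ t → a t ≈ b t
  lc-injective ys independent {a} {b} a≈b t =
    x∙y⁻¹≈ε⇒x≈y (a t) (b t) (independent (λ t → a t - b t) difference t)
    where
    difference : lc ys (λ t → a t - b t) ≈V 0V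
    difference p = begin
      lc ys (λ t → a t - b t) p              ≈⟨ lc-+ ys a (λ t → - b t) p ⟩
      lc ys a p + lc ys (λ t → - b t) p      ≈⟨ +-congˡ (lc-cong ys (λ t → -1*x≈-x (b t)) p) ⟨
      lc ys a p + lc ys (λ t → - 1# * b t) p ≈⟨ +-congˡ (lc-* ys (- 1#) b p) ⟩
      lc ys a p + - 1# * lc ys b p           ≈⟨ +-congˡ (-1*x≈-x _) ⟩
      lc ys a p - lc ys b p                  ≈⟨ +-congˡ (-‿cong (a≈b p)) ⟨
      lc ys a p - lc ys a p                  ≈⟨ -‿inverseʳ _ ⟩
      0#                                     ∎

  SupportedUpTo : ∀ {d} → Fin d → V d → Set ℓ
  SupportedUpTo p v = ∀ q → p Fin.< q → v q ≈ 0#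

  LeadsAt : ∀ {d} → Fin d → V d → Set ℓ
  LeadsAt p v = SupportedUpTo p v × ¬ v p ≈ 0#

  vanishes-from : ∀ {d} {p : Fin d} {v} → v p ≈ 0# → SupportedUpTo p v →
                  ∀ q → p Fin.≤ q → v q ≈ 0#
  vanishes-from {v = v} vₚ≈0 supported q p≤q with ℕₚ.m≤n⇒m<n∨m≡n p≤q
  ... | inj₁ p<q = supported q p<q
  ... | inj₂ p≡q = ≡.subst (λ r → v r ≈ 0#) (Finₚ.toℕ-injective p≡q) vₚ≈0

  AllInSpan⇒All : ∀ {d} {xs ys : List (V d)} → AllInSpan xs ys → All (λ x → InSpan x ys) xs
  AllInSpan⇒All {xs = []}    _        = []
  AllInSpan⇒All {xs = _ ∷ _} (x , xs) = x ∷ AllInSpan⇒All xs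

  flag-supported : ∀ {d} (l : Fin d) {v} → InSpan v (flagVecs l) → SupportedUpTo l v
  flag-supported {d} l (a , v≈lc) q l<q =
    trans (v≈lc q) (lc-vanishing (flagVecs l) a q (λ t → inj₂ (vanishes (∈-lookup t))))
    where
    vanishes : ∀ {y} → y ∈ flagVecs l → y q ≈ 0#
    vanishes y∈ with ∈-map⁻ e y∈
    ... | r , r∈ , ≡.refl = reflexive (e-off (λ q≡r → ℕₚ.<⇒≱ l<q (≡.subst (Fin._≤ l) (≡.sym q≡r) r≤l)))
      where
      r≤l : r Fin.≤ l
      r≤l = T-does⁻¹ (r Fin.≤? l) (proj₂ (∈-filter⁻ (T? ∘ (_≤ᵇ l)) {xs = allFin d} r∈))

  Entries : ℕ → Set c
  Entries d = List (Fin d × V d)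

  vectors : ∀ {d} → Entries d → List (V d)
  vectors = map proj₂

  Slot : ∀ {d} → Entries d → Set
  Slot ss = Fin (length (vectors ss))

  entryAt : ∀ {d} (ss : Entries d) → Slot ss → Fin d × V d
  entryAt (x ∷ _)  Fin.zero    = x
  entryAt (_ ∷ ss) (Fin.suc t) = entryAt ss t

  entryAt-∈ : ∀ {d} (ss : Entries d) t → entryAt ss t ∈ ss
  entryAt-∈ (_ ∷ _)  Fin.zero    = here ≡.refl
  entryAt-∈ (_ ∷ ss) (Fin.suc t) = there (entryAt-∈ ss t)

  lookup-vectors : ∀ {d} (ss : Entries d) t → lookup (vectors ss) t ≡ proj₂ (entryAt ss t)
  lookup-vectors (_ ∷ _)  Fin.zero    = ≡.refl
  lookup-vectors (_ ∷ ss) (Fin.suc t) = lookup-vectors ss t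

  lc-basis : ∀ {d} (ss : Entries d) t → lc (vectors ss) (e t) ≈V proj₂ (entryAt ss t)
  lc-basis (x ∷ ss) Fin.zero p =
    trans (+-cong (*-identityˡ _) (lc-zero (vectors ss) (λ _ → refl) p)) (+-identityʳ _)
  lc-basis (x ∷ ss) (Fin.suc t) p =
    trans (+-cong (zeroˡ _) (lc-basis ss t p)) (+-identityˡ _)

  All-by-slots : ∀ {d p} {P : Fin d × V d → Set p} (ss : Entries d) →
                 (∀ t → P (entryAt ss t)) → All P ss
  All-by-slots []       _   = []
  All-by-slots (_ ∷ ss) all = all Fin.zero ∷ All-by-slots ss (all ∘ Fin.suc)

  Unique-by-slots : ∀ {d} (ss : Entries d) →
                    (∀ s t → proj₁ (entryAt ss s) ≡ proj₁ (entryAt ss t) → s ≡ t) →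
                    Unique (map proj₁ ss)
  Unique-by-slots []       _         = []
  Unique-by-slots (_ ∷ ss) injective =
    AllP.map⁺ (All-by-slots ss (λ t eq → zero≢suc (injective Fin.zero (Fin.suc t) eq))) ∷
    Unique-by-slots ss (λ s t eq → Finₚ.suc-injective (injective (Fin.suc s) (Fin.suc t) eq))
    where
    zero≢suc : ∀ {n} {t : Fin n} → Fin.zero ≢ Fin.suc t
    zero≢suc ()

  record SpannedBy {d} (ss : Entries d) (P : Fin d → Bool) (w : V d) : Set (c ⊔ ℓ) where
    constructor spanned
    field
      coeff          : Slot ss → Carrier
      ≈lc            : w ≈V lc (vectors ss) coeff
      coeff-vanishes : ∀ t → ¬ T (P (proj₁ (entryAt ss t))) → coeff t ≈ 0#

  module _ {d} {ss : Entries d} {P : Fin d → Bool} where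

    spannedBy-resp : ∀ {w w′} → w ≈V w′ → SpannedBy ss P w → SpannedBy ss P w′
    spannedBy-resp w≈w′ (spanned a w≈lc a≈0) = spanned a (λ p → trans (sym (w≈w′ p)) (w≈lc p)) a≈0

    spannedBy-0V : SpannedBy ss P 0V
    spannedBy-0V = spanned (λ _ → 0#) (λ p → sym (lc-zero (vectors ss) (λ _ → refl) p)) (λ _ _ → refl)

    spannedBy-+ : ∀ {u w} → SpannedBy ss P u → SpannedBy ss P w → SpannedBy ss P (u +V w)
    spannedBy-+ (spanned a u≈ a≈0) (spanned b w≈ b≈0) = spanned
      (λ t → a t + b t)
      (λ p → trans (+-cong (u≈ p) (w≈ p)) (sym (lc-+ (vectors ss) a b p)))
      (λ t ¬P → trans (+-cong (a≈0 t ¬P) (b≈0 t ¬P)) (+-identityʳ 0#))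

    spannedBy-• : ∀ k {w} → SpannedBy ss P w → SpannedBy ss P (k • w)
    spannedBy-• k (spanned a w≈ a≈0) = spanned
      (λ t → k * a t)
      (λ p → trans (*-congˡ (w≈ p)) (sym (lc-* (vectors ss) k a p)))
      (λ t ¬P → trans (*-congˡ (a≈0 t ¬P)) (zeroʳ k))

    spannedBy-sum : ∀ {n} (G : Fin n → V d) → (∀ q → SpannedBy ss P (G q)) →
                    SpannedBy ss P (λ p → sum (λ q → G q p))
    spannedBy-sum {zero}  G G-spanned = spannedBy-0V
    spannedBy-sum {suc n} G G-spanned =
      spannedBy-+ (G-spanned Fin.zero) (spannedBy-sum (G ∘ Fin.suc) (G-spanned ∘ Fin.suc))

  spannedBy-mono : ∀ {d} {ss : Entries d} {P Q : Fin d → Bool} {w} →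
                   (∀ r → T (P r) → T (Q r)) → SpannedBy ss P w → SpannedBy ss Q w
  spannedBy-mono P⊆Q (spanned a w≈ a≈0) = spanned a w≈ λ t ¬Q → a≈0 t (¬Q ∘ P⊆Q _)

  spannedBy-filter : ∀ {d} (P : Fin d → Bool) (ss : Entries d) a →
                     SpannedBy ss P (lc (vectors (filterᵇ (P ∘ proj₁) ss)) a)
  spannedBy-filter P [] a = spanned (λ ()) (λ _ → refl) (λ ())
  spannedBy-filter P ((p , v) ∷ ss) a with P p in Pp
  ... | true =
    let spanned b w≈ b≈0 = spannedBy-filter P ss (a ∘ Fin.suc) in spanned
    (λ { Fin.zero → a Fin.zero ; (Fin.suc t) → b t })
    (λ q → +-congˡ (w≈ q))
    (λ { Fin.zero ¬P → ⊥-elim (¬P (≡.subst T (≡.sym Pp) tt)) ; (Fin.suc t) → b≈0 t })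
  ... | false =
    let spanned b w≈ b≈0 = spannedBy-filter P ss a in spanned
    (λ { Fin.zero → 0# ; (Fin.suc t) → b t })
    (λ q → trans (w≈ q) (sym (trans (+-congʳ (zeroˡ _)) (+-identityˡ _))))
    (λ { Fin.zero _ → refl ; (Fin.suc t) → b≈0 t })

  module Echelon {d} (ss : Entries d) (independent : LinIndep (vectors ss))
    (levels : ∀ l → SameSpan (vectors (filterᵇ ((_≤ᵇ l) ∘ proj₁) ss)) (flagVecs l)) where

    entry : Slot ss → Fin d
    entry = proj₁ ∘ entryAt ss

    vec : Slot ss → V d
    vec = proj₂ ∘ entryAt ss

    _<ᵇ_ : Fin d → Fin d → Bool
    r <ᵇ e₀ = does (r Fin.<? e₀)

    vec-supported : ∀ t → SupportedUpTo (entry t) (vec t)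
    vec-supported t = flag-supported (entry t)
      (All.lookup (AllInSpan⇒All (proj₁ (levels (entry t))))
        (∈-map⁺ proj₂ (∈-filter⁺ (T? ∘ (_≤ᵇ entry t) ∘ proj₁) (entryAt-∈ ss t)
                                  (T-does (entry t Fin.≤? entry t) Finₚ.≤-refl))))

    basis-spanned : ∀ {l q} → q Fin.≤ l → SpannedBy ss (_≤ᵇ l) (e q)
    basis-spanned {l} {q} q≤l
      with All.lookup (AllInSpan⇒All (proj₂ (levels l)))
             (∈-map⁺ e (∈-filter⁺ (T? ∘ (_≤ᵇ l)) (∈-allFin q) (T-does (q Fin.≤? l) q≤l)))
    ... | a , eq≈lc = spannedBy-resp (sym ∘ eq≈lc) (spannedBy-filter (_≤ᵇ l) ss a)

    supported-below : ∀ {e₀ w} → (∀ q → e₀ Fin.≤ q → w q ≈ 0#) → SpannedBy ss (_<ᵇ e₀) w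
    supported-below {e₀} {w} w≈0 =
      spannedBy-resp (sym ∘ coordinates w) (spannedBy-sum (λ q → w q • e q) term)
      where
      term : ∀ q → SpannedBy ss (_<ᵇ e₀) (w q • e q)
      term q with q Fin.<? e₀
      ... | yes q<e₀ = spannedBy-• (w q) (spannedBy-mono
              (λ r r≤q → T-does (r Fin.<? e₀) (ℕₚ.≤-<-trans (T-does⁻¹ (r Fin.≤? q) r≤q) q<e₀))
              (basis-spanned Finₚ.≤-refl))
      ... | no q≮e₀ = spannedBy-resp (λ p → sym (trans (*-congʳ (w≈0 q (ℕₚ.≮⇒≥ q≮e₀))) (zeroˡ _)))
                                     spannedBy-0V

    coefficients-vanish : ∀ {e₀ a} → (∀ q → e₀ Fin.≤ q → lc (vectors ss) a q ≈ 0#) →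
                          ∀ t → e₀ Fin.≤ entry t → a t ≈ 0#
    coefficients-vanish {e₀} lc≈0 t e₀≤t with supported-below lc≈0
    ... | spanned b lc≈lc-b b≈0 =
      trans (lc-injective (vectors ss) independent lc≈lc-b t)
            (b≈0 t (λ t<e₀ → ℕₚ.<⇒≱ (T-does⁻¹ (entry t Fin.<? e₀) t<e₀) e₀≤t))

    vec-nonzero : ∀ t → ¬ vec t (entry t) ≈ 0#
    vec-nonzero t vₜ≈0 = 1≉0 (begin
      1#     ≡⟨ e-diag t ⟨
      e t t  ≈⟨ coefficients-vanish vanish t Finₚ.≤-refl ⟩
      0#     ∎)
      where
      vanish : ∀ q → entry t Fin.≤ q → lc (vectors ss) (e t) q ≈ 0#
      vanish q t≤q = trans (lc-basis ss t q) (vanishes-from vₜ≈0 (vec-supported t) q t≤q)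

    -- Two vectors leading at the same index have a combination vanishing there,
    -- whose coefficients must then vanish too.
    entry-injective : ∀ s t → entry s ≡ entry t → s ≡ t
    entry-injective s t eₛ≡eₜ with s Fin.≟ t
    ... | yes s≡t = s≡t
    ... | no s≢t  = ⊥-elim (vec-nonzero t cₜ≈0)
      where
      e₀ = entry t
      cₛ = vec s e₀
      cₜ = vec t e₀

      a : Slot ss → Carrier
      a r = cₜ * e s r + - cₛ * e t r

      lc-a : lc (vectors ss) a ≈V ((cₜ • vec s) +V ((- cₛ) • vec t))
      lc-a p = trans (lc-+ (vectors ss) _ _ p)
        (+-cong (trans (lc-* (vectors ss) cₜ (e s) p) (*-congˡ (lc-basis ss s p)))
                (trans (lc-* (vectors ss) (- cₛ) (e t) p) (*-congˡ (lc-basis ss t p))))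

      lc-a-supported : SupportedUpTo e₀ (lc (vectors ss) a)
      lc-a-supported q e₀<q = trans (lc-a q) (trans
        (+-cong (trans (*-congˡ (vec-supported s q (≡.subst (Fin._< q) (≡.sym eₛ≡eₜ) e₀<q))) (zeroʳ _))
                (trans (*-congˡ (vec-supported t q e₀<q)) (zeroʳ _)))
        (+-identityʳ 0#))

      lc-a-at-e₀ : lc (vectors ss) a e₀ ≈ 0#
      lc-a-at-e₀ = begin
        lc (vectors ss) a e₀    ≈⟨ lc-a e₀ ⟩
        cₜ * cₛ + - cₛ * cₜ     ≈⟨ +-cong (*-comm cₛ cₜ) (-‿distribˡ-* cₛ cₜ) ⟨
        cₛ * cₜ - cₛ * cₜ       ≈⟨ -‿inverseʳ _ ⟩
        0#                      ∎

      aₛ≈cₜ : a s ≈ cₜ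
      aₛ≈cₜ = begin
        cₜ * e s s + - cₛ * e t s  ≡⟨ ≡.cong₂ (λ x y → cₜ * x + - cₛ * y) (e-diag s) (e-off s≢t) ⟩
        cₜ * 1# + - cₛ * 0#        ≈⟨ +-cong (*-identityʳ cₜ) (zeroʳ _) ⟩
        cₜ + 0#                    ≈⟨ +-identityʳ cₜ ⟩
        cₜ                         ∎

      cₜ≈0 : cₜ ≈ 0#
      cₜ≈0 = trans (sym aₛ≈cₜ)
        (coefficients-vanish (vanishes-from lc-a-at-e₀ lc-a-supported) s
                             (ℕₚ.≤-reflexive (≡.cong toℕ (≡.sym eₛ≡eₜ))))

    -- If no vector led at p, the vectors spanning U_p would all vanish at p.
    entry-surjective : ∀ p → ∃ λ t → entry t ≡ p
    entry-surjective p with Finₚ.any? (λ t → entry t Fin.≟ p)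
    ... | yes found = found
    ... | no none with basis-spanned {p} Finₚ.≤-refl
    ...   | spanned a eₚ≈lc a≈0 = ⊥-elim (1≉0 (begin
      1#                   ≡⟨ e-diag p ⟨
      e p p                ≈⟨ eₚ≈lc p ⟩
      lc (vectors ss) a p  ≈⟨ lc-vanishing (vectors ss) a p slot-vanishes ⟩
      0#                   ∎))
      where
      slot-vanishes : ∀ t → a t ≈ 0# ⊎ lookup (vectors ss) t p ≈ 0#
      slot-vanishes t with entry t Fin.≤? p
      ... | no t≰p  = inj₁ (a≈0 t (t≰p ∘ T-does⁻¹ (entry t Fin.≤? p)))
      ... | yes t≤p = inj₂ (trans (reflexive (≡.cong (λ v → v p) (lookup-vectors ss t)))
                                  (vec-supported t p (Finₚ.≤∧≢⇒< t≤p (λ eq → none (t , eq)))))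

    leads : All (uncurry LeadsAt) ss
    leads = All-by-slots ss (λ t → vec-supported t , vec-nonzero t)

    entries-unique : Unique (map proj₁ ss)
    entries-unique = Unique-by-slots ss entry-injective

    entries-total : ∀ p → p ∈ map proj₁ ss
    entries-total p with entry-surjective p
    ... | t , ≡.refl = ∈-map⁺ proj₁ (entryAt-∈ ss t)

  inU2m-opposite : ∀ m n p → inU2m m n (opposite p) ≡ inU2m m n p
  inU2m-opposite m n p = ≡.trans
    (≡.cong₂ _∧_ (does-⇔ (≤-complement k+1+p≡) (n ℕ.≤? k) (toℕ p ℕ.<? a))
                 (does-⇔ (⇔.sym (≤-complement p+1+k≡)) (k ℕ.<? a) (n ℕ.≤? toℕ p)))
    (Boolₚ.∧-comm (does (toℕ p ℕ.<? a)) (does (n ℕ.≤? toℕ p)))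
    where
    open +-*-Solver
    k = toℕ (opposite p)
    a = n ℕ.+ (m ℕ.+ m)
    size : (m ℕ.+ n) ℕ.+ (m ℕ.+ n) ≡ a ℕ.+ n
    size = solve 2 (λ m n → (m :+ n) :+ (m :+ n) := (n :+ (m :+ m)) :+ n) ≡.refl m n
    k+1+p≡ : k ℕ.+ suc (toℕ p) ≡ a ℕ.+ n
    k+1+p≡ = ≡.trans (≡.cong (ℕ._+ suc (toℕ p)) (Finₚ.opposite-prop p))
                     (≡.trans (ℕₚ.m∸n+n≡m (Finₚ.toℕ<n p)) size)
    p+1+k≡ : toℕ p ℕ.+ suc k ≡ a ℕ.+ n
    p+1+k≡ = ≡.trans (ℕₚ.+-suc (toℕ p) k) (≡.trans (≡.cong suc (ℕₚ.+-comm (toℕ p) k))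
                     (≡.trans (≡.sym (ℕₚ.+-suc k (toℕ p))) k+1+p≡))

  module Form (N : ℕ) where

    sgn : Fin (N ℕ.+ N) → Carrier
    sgn p = if does (toℕ p ℕ.<? N) then 1# else - 1#

    sgn≉0 : ∀ p → ¬ sgn p ≈ 0#
    sgn≉0 p with does (toℕ p ℕ.<? N)
    ... | true  = 1≉0
    ... | false = -1≉0

    -- ⟪ N ⟫⟨_,_⟩ with the vanishing entries of its Gram matrix dropped
    summand : V (N ℕ.+ N) → V (N ℕ.+ N) → Fin (N ℕ.+ N) → Carrier
    summand u w p = u p * (sgn p * w (opposite p))

    ⟨_,_⟩ : V (N ℕ.+ N) → V (N ℕ.+ N) → Carrier
    ⟨ u , w ⟩ = sum (summand u w)

    ⟪⟫≈⟨⟩ : ∀ u w → ⟪ N ⟫⟨ u , w ⟩ ≈ ⟨ u , w ⟩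
    ⟪⟫≈⟨⟩ u w = trans (reflexive (∑≡sum (λ p → ∑ (λ q → u p * (Jform N p q * w q))))) (sum-cong-≋ row)
      where
      J-diag : ∀ p → Jform N p (opposite p) ≡ sgn p
      J-diag p with opposite p Fin.≟ opposite p
      ... | yes _  = ≡.refl
      ... | no ≢p = ⊥-elim (≢p ≡.refl)
      J-off : ∀ {p q} → q ≢ opposite p → Jform N p q ≡ 0#
      J-off {p} {q} q≢ with q Fin.≟ opposite p
      ... | yes q≡ = ⊥-elim (q≢ q≡)
      ... | no _   = ≡.refl
      row : ∀ p → ∑ (λ q → u p * (Jform N p q * w q)) ≈ summand u w p
      row p = trans (reflexive (∑≡sum (λ q → u p * (Jform N p q * w q)))) (trans (sum-single (opposite p) off)
                    (*-congˡ (*-congʳ (reflexive (J-diag p)))))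
        where
        off : ∀ q → q ≢ opposite p → u p * (Jform N p q * w q) ≈ 0#
        off q q≢ = trans (*-congˡ (trans (*-congʳ (reflexive (J-off q≢))) (zeroˡ _))) (zeroʳ _)

    ⟨⟩-cong : ∀ {u u′ w w′} → u ≈V u′ → w ≈V w′ → ⟨ u , w ⟩ ≈ ⟨ u′ , w′ ⟩
    ⟨⟩-cong {u} {u′} {w} {w′} u≈ w≈ = sum-cong-≋ pointwise
      where
      pointwise : ∀ p → summand u w p ≈ summand u′ w′ p
      pointwise p = *-cong (u≈ p) (*-congˡ (w≈ (opposite p)))

    ⟨+,⟩ : ∀ u v w → ⟨ u +V v , w ⟩ ≈ ⟨ u , w ⟩ + ⟨ v , w ⟩
    ⟨+,⟩ u v w = trans (sum-cong-≋ (λ p → distribʳ _ (u p) (v p))) (∑-distrib-+ (summand u w) (summand v w))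

    ⟨,+⟩ : ∀ u v w → ⟨ u , v +V w ⟩ ≈ ⟨ u , v ⟩ + ⟨ u , w ⟩
    ⟨,+⟩ u v w = trans (sum-cong-≋ (λ p → trans (*-congˡ (distribˡ (sgn p) _ _)) (distribˡ (u p) _ _)))
                       (∑-distrib-+ (summand u v) (summand u w))

    ⟨•,⟩ : ∀ k u w → ⟨ k • u , w ⟩ ≈ k * ⟨ u , w ⟩
    ⟨•,⟩ k u w = trans (sum-cong-≋ (λ p → *-assoc k (u p) _)) (sym (*-distribˡ-sum k (summand u w)))

    ⟨,•⟩ : ∀ k u w → ⟨ u , k • w ⟩ ≈ k * ⟨ u , w ⟩
    ⟨,•⟩ k u w = trans (sum-cong-≋ (λ p → trans (*-congˡ (x∙yz≈y∙xz (sgn p) k _)) (x∙yz≈y∙xz (u p) k _)))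
                       (sym (*-distribˡ-sum k (summand u w)))

    term≈0 : ∀ u w p → u p ≈ 0# ⊎ w (opposite p) ≈ 0# → summand u w p ≈ 0#
    term≈0 u w p (inj₁ u≈0) = trans (*-congʳ u≈0) (zeroˡ _)
    term≈0 u w p (inj₂ w≈0) = trans (*-congˡ (trans (*-congˡ w≈0) (zeroʳ _))) (zeroʳ _)

    ⟨⟩-vanishes : ∀ u w → (∀ p → u p ≈ 0# ⊎ w (opposite p) ≈ 0#) → ⟨ u , w ⟩ ≈ 0#
    ⟨⟩-vanishes u w vanish = sum-zero (λ p → term≈0 u w p (vanish p))

    ⟨lc,⟩≈0 : ∀ xs a w → (∀ {x} → x ∈ xs → ⟨ x , w ⟩ ≈ 0#) → ⟨ lc xs a , w ⟩ ≈ 0#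
    ⟨lc,⟩≈0 []       a w _  = ⟨⟩-vanishes 0V w (λ _ → inj₁ refl)
    ⟨lc,⟩≈0 (x ∷ xs) a w ⊥w = begin
      ⟨ (a Fin.zero • x) +V lc xs (a ∘ Fin.suc) , w ⟩          ≈⟨ ⟨+,⟩ (a Fin.zero • x) (lc xs (a ∘ Fin.suc)) w ⟩
      ⟨ a Fin.zero • x , w ⟩ + ⟨ lc xs (a ∘ Fin.suc) , w ⟩     ≈⟨ +-cong head≈0 (⟨lc,⟩≈0 xs (a ∘ Fin.suc) w (⊥w ∘ there)) ⟩
      0# + 0#                                                 ≈⟨ +-identityʳ 0# ⟩
      0#                                                      ∎
      where
      head≈0 = trans (⟨•,⟩ (a Fin.zero) x w) (trans (*-congˡ (⊥w (here ≡.refl))) (zeroʳ _))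

    ⟨,lc⟩≈0 : ∀ ys b u → (∀ {y} → y ∈ ys → ⟨ u , y ⟩ ≈ 0#) → ⟨ u , lc ys b ⟩ ≈ 0#
    ⟨,lc⟩≈0 []       b u _  = ⟨⟩-vanishes u 0V (λ _ → inj₂ refl)
    ⟨,lc⟩≈0 (y ∷ ys) b u u⊥ = begin
      ⟨ u , (b Fin.zero • y) +V lc ys (b ∘ Fin.suc) ⟩          ≈⟨ ⟨,+⟩ u (b Fin.zero • y) (lc ys (b ∘ Fin.suc)) ⟩
      ⟨ u , b Fin.zero • y ⟩ + ⟨ u , lc ys (b ∘ Fin.suc) ⟩     ≈⟨ +-cong head≈0 (⟨,lc⟩≈0 ys (b ∘ Fin.suc) u (u⊥ ∘ there)) ⟩
      0# + 0#                                                 ≈⟨ +-identityʳ 0# ⟩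
      0#                                                      ∎
      where
      head≈0 = trans (⟨,•⟩ (b Fin.zero) u y) (trans (*-congˡ (u⊥ (here ≡.refl))) (zeroʳ _))

    ⟨⟩-leads-opposite : ∀ {a u w} → LeadsAt a u → LeadsAt (opposite a) w → ¬ ⟨ u , w ⟩ ≈ 0#
    ⟨⟩-leads-opposite {a} {u} {w} (u-supported , uₐ≉0) (w-supported , w≉0) ⟨u,w⟩≈0 =
      x*y≉0 uₐ≉0 (x*y≉0 (sgn≉0 a) w≉0) (trans (sym (sum-single a off)) ⟨u,w⟩≈0)
      where
      off : ∀ p → p ≢ a → summand u w p ≈ 0#
      off p p≢a with Finₚ.<-cmp p a
      ... | tri< p<a _ _ = term≈0 u w p (inj₂ (w-supported _ (opposite-< p<a)))
      ... | tri≈ _ p≡a _ = ⊥-elim (p≢a p≡a)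
      ... | tri> _ _ a<p = term≈0 u w p (inj₁ (u-supported p a<p))

    ⟨⟩-supports-apart : ∀ {a b u w} → SupportedUpTo a u → SupportedUpTo b w →
                        a Fin.< opposite b → ⟨ u , w ⟩ ≈ 0#
    ⟨⟩-supports-apart {a} {b} {u} {w} u-supported w-supported a<b̄ = ⟨⟩-vanishes u w vanish
      where
      vanish : ∀ p → u p ≈ 0# ⊎ w (opposite p) ≈ 0#
      vanish p with a Fin.<? p
      ... | yes a<p = inj₁ (u-supported p a<p)
      ... | no a≮p  = inj₂ (w-supported _ (≡.subst (Fin._< opposite p) (Finₚ.opposite-involutive b)
                                             (opposite-< (ℕₚ.≤-<-trans (ℕₚ.≮⇒≥ a≮p) a<b̄))))

    ⟨⟩-cross : ∀ {i q} x y x′ y′ → SupportedUpTo i x → SupportedUpTo q y′ → i Fin.< opposite q →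
               ⟨ x +V y , y′ ⟩ ≈ 0# → ⟨ y , x′ +V y′ ⟩ ≈ 0# → ⟨ y , x′ ⟩ ≈ 0#
    ⟨⟩-cross x y x′ y′ x-supported y′-supported i<q̄ x+y⊥y′ y⊥x′+y′ = begin
      ⟨ y , x′ ⟩               ≈⟨ +-identityʳ _ ⟨
      ⟨ y , x′ ⟩ + 0#          ≈⟨ +-congˡ ⟨y,y′⟩≈0 ⟨
      ⟨ y , x′ ⟩ + ⟨ y , y′ ⟩  ≈⟨ ⟨,+⟩ y x′ y′ ⟨
      ⟨ y , x′ +V y′ ⟩         ≈⟨ y⊥x′+y′ ⟩
      0#                       ∎
      where
      ⟨y,y′⟩≈0 : ⟨ y , y′ ⟩ ≈ 0#
      ⟨y,y′⟩≈0 = begin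
        ⟨ y , y′ ⟩               ≈⟨ +-identityˡ _ ⟨
        0# + ⟨ y , y′ ⟩          ≈⟨ +-congʳ (⟨⟩-supports-apart x-supported y′-supported i<q̄) ⟨
        ⟨ x , y′ ⟩ + ⟨ y , y′ ⟩  ≈⟨ ⟨+,⟩ x y y′ ⟨
        ⟨ x +V y , y′ ⟩          ≈⟨ x+y⊥y′ ⟩
        0#                       ∎

  module Orthogonality (m n : ℕ) (g h : Mat ((m ℕ.+ n) ℕ.+ (m ℕ.+ n)))
    (preserves : ∀ v w → ⟪ m ℕ.+ n ⟫⟨ v , w ⟩ ≈ ⟪ m ℕ.+ n ⟫⟨ g · v , h · w ⟩) where

    open Form (m ℕ.+ n)

    images-orthogonal :
      (P Q : Fin _ → Bool) → (∀ {q r} → T (P q) → T (Q r) → r ≢ opposite q) →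
      ∀ {u w} → InSpan u (map (λ q → g · e q) (filterPos P)) →
      InSpan w (map (λ r → h · e r) (filterPos Q)) → ⟨ u , w ⟩ ≈ 0#
    images-orthogonal P Q apart (a , u≈) (b , w≈) =
      trans (⟨⟩-cong u≈ w≈) (⟨lc,⟩≈0 gs a (lc hs b) (λ {x} x∈ → ⟨,lc⟩≈0 hs b x (generators x∈)))
      where
      gs = map (λ q → g · e q) (filterPos P)
      hs = map (λ r → h · e r) (filterPos Q)
      generators : ∀ {x y} → x ∈ gs → y ∈ hs → ⟨ x , y ⟩ ≈ 0#
      generators x∈ y∈ with ∈-map⁻ _ x∈ | ∈-map⁻ _ y∈
      ... | q , q∈ , ≡.refl | r , r∈ , ≡.refl = begin
        ⟨ g · e q , h · e r ⟩            ≈⟨ ⟪⟫≈⟨⟩ _ _ ⟨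
        ⟪ m ℕ.+ n ⟫⟨ g · e q , h · e r ⟩ ≈⟨ preserves (e q) (e r) ⟨
        ⟪ m ℕ.+ n ⟫⟨ e q , e r ⟩         ≈⟨ ⟪⟫≈⟨⟩ _ _ ⟩
        ⟨ e q , e r ⟩                    ≈⟨ ⟨⟩-vanishes (e q) (e r) basis-apart ⟩
        0#                               ∎
        where
        r≢q̄ : r ≢ opposite q
        r≢q̄ = apart (proj₂ (∈-filter⁻ (T? ∘ P) {xs = allFin _} q∈))
                    (proj₂ (∈-filter⁻ (T? ∘ Q) {xs = allFin _} r∈))
        basis-apart : ∀ p → e q p ≈ 0# ⊎ e r (opposite p) ≈ 0#
        basis-apart p with p Fin.≟ q
        ... | no _       = inj₁ refl
        ... | yes ≡.refl = inj₂ (reflexive (e-off (r≢q̄ ∘ ≡.sym)))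

    inU2m-apart : ∀ {q r} → T (inU2m m n q) → T (not (inU2m m n r)) → r ≢ opposite q
    inU2m-apart {q} q∈ r∉ ≡.refl = T-not-T r∉ (≡.subst T (≡.sym (inU2m-opposite m n q)) q∈)

    A⊥A′ : ∀ {u w} → InSpan u (AVecs m n g) → InSpan w (A'Vecs m n h) → ⟨ u , w ⟩ ≈ 0#
    A⊥A′ = images-orthogonal (inU2m m n) (not ∘ inU2m m n) inU2m-apart

    A′⊥A : ∀ {u w} → InSpan u (A'Vecs m n g) → InSpan w (AVecs m n h) → ⟨ u , w ⟩ ≈ 0#
    A′⊥A = images-orthogonal (not ∘ inU2m m n) (inU2m m n) (λ r∉ q∈ → inU2m-apart q∈ r∉ ∘ opposite-flip)
      where
      opposite-flip : ∀ {q r : Fin _} → r ≡ opposite q → q ≡ opposite r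
      opposite-flip {q} ≡.refl = ≡.sym (Finₚ.opposite-involutive q)

  LeadsAt-+ : ∀ {d} {i j : Fin d} {x y} → i Fin.< j → SupportedUpTo i x → LeadsAt j y → LeadsAt j (x +V y)
  LeadsAt-+ i<j x-supported (y-supported , yⱼ≉0) =
    (λ q j<q → trans (+-cong (x-supported q (ℕₚ.<-trans i<j j<q)) (y-supported q j<q)) (+-identityʳ 0#)) ,
    (λ xⱼ+yⱼ≈0 → yⱼ≉0 (trans (sym (trans (+-congʳ (x-supported _ i<j)) (+-identityˡ _))) xⱼ+yⱼ≈0))

module Pieces {c ℓ} (R : CommutativeRing c ℓ) (isField : IsField R) where

  open CommutativeRing R hiding (zero)
  open LinAlg R
  open Linear R isField

  module _ {d : ℕ} where

    pieceEntries : Piece d → Entries d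
    pieceEntries (pieceA i x)       = (i , x) ∷ []
    pieceEntries (pieceB i x)       = (i , x) ∷ []
    pieceEntries (pieceC i j _ x y) = (i , x) ∷ (j , y) ∷ []

    entriesOf : List (Piece d) → Entries d
    entriesOf = concatMap pieceEntries

    vectors-entriesOf : ∀ D → concatMap vecsOf D ≡ vectors (entriesOf D)
    vectors-entriesOf D =
      ≡.trans (Listₚ.concatMap-cong piece D) (≡.sym (Listₚ.map-concatMap proj₂ pieceEntries D))
      where
      piece : ∀ P → vecsOf P ≡ vectors (pieceEntries P)
      piece (pieceA _ _)       = ≡.refl
      piece (pieceB _ _)       = ≡.refl
      piece (pieceC _ _ _ _ _) = ≡.refl

    keys-entriesOf : ∀ D → map proj₁ (entriesOf D) ≡ map proj₁ (concatMap kindRoles (map kindOf D))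
    keys-entriesOf D = begin
      map proj₁ (concatMap pieceEntries D)              ≡⟨ Listₚ.map-concatMap proj₁ pieceEntries D ⟩
      concatMap (map proj₁ ∘ pieceEntries) D            ≡⟨ Listₚ.concatMap-cong piece D ⟩
      concatMap (map proj₁ ∘ kindRoles ∘ kindOf) D      ≡⟨ Listₚ.concatMap-map (map proj₁ ∘ kindRoles) kindOf D ⟨
      concatMap (map proj₁ ∘ kindRoles) (map kindOf D)  ≡⟨ Listₚ.map-concatMap proj₁ kindRoles (map kindOf D) ⟨
      map proj₁ (concatMap kindRoles (map kindOf D))    ∎
      where
      open ≡.≡-Reasoning
      piece : ∀ P → map proj₁ (pieceEntries P) ≡ map proj₁ (kindRoles (kindOf P))
      piece (pieceA _ _)       = ≡.refl
      piece (pieceB _ _)       = ≡.refl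
      piece (pieceC _ _ _ _ _) = ≡.refl

    levels-entriesOf : ∀ l D → concatMap (levelOf l) D ≡ vectors (filterᵇ ((_≤ᵇ l) ∘ proj₁) (entriesOf D))
    levels-entriesOf l []      = ≡.refl
    levels-entriesOf l (P ∷ D) = begin
      levelOf l P ++ concatMap (levelOf l) D                     ≡⟨ ≡.cong₂ _++_ (piece P) (levels-entriesOf l D) ⟩
      vectors (filterᵇ F (pieceEntries P)) ++ vectors (filterᵇ F (entriesOf D))
        ≡⟨ Listₚ.map-++ proj₂ (filterᵇ F (pieceEntries P)) _ ⟨
      vectors (filterᵇ F (pieceEntries P) ++ filterᵇ F (entriesOf D))
        ≡⟨ ≡.cong vectors (Listₚ.filter-++ (T? ∘ F) (pieceEntries P) (entriesOf D)) ⟨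
      vectors (filterᵇ F (pieceEntries P ++ entriesOf D))        ∎
      where
      open ≡.≡-Reasoning
      F : Fin d × V d → Bool
      F = (_≤ᵇ l) ∘ proj₁
      piece : ∀ P → levelOf l P ≡ vectors (filterᵇ F (pieceEntries P))
      piece (pieceA i _) with i ≤ᵇ l
      ... | true  = ≡.refl
      ... | false = ≡.refl
      piece (pieceB i _) with i ≤ᵇ l
      ... | true  = ≡.refl
      ... | false = ≡.refl
      piece (pieceC i j i<j _ _) with i ≤ᵇ l in i≤
      ... | true with j ≤ᵇ l
      ...   | true  = ≡.refl
      ...   | false = ≡.refl
      piece (pieceC i j i<j _ _) | false with j ≤ᵇ l in j≤
      ...   | false = ≡.refl
      ...   | true  = ⊥-elim (≡.subst T i≤ (T-does (i Fin.≤? l)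
                (ℕₚ.<⇒≤ (ℕₚ.<-≤-trans i<j (T-does⁻¹ (j Fin.≤? l) (≡.subst T (≡.sym j≤) tt))))))

  vector-in-A : ∀ {d} (P : Piece d) {p t S} → (p , t) ∈ kindRoles (kindOf P) → T (inA t) →
                All (uncurry LeadsAt) (pieceEntries P) → All (λ u → InSpan u S) (aOf P) →
                ∃ λ u → InSpan u S × LeadsAt p u
  vector-in-A (pieceA _ x)       (here ≡.refl)         _ (x-leads ∷ [])     (x∈ ∷ []) = x , x∈ , x-leads
  vector-in-A (pieceC _ _ _ _ y) (there (here ≡.refl)) _ (_ ∷ y-leads ∷ []) (y∈ ∷ []) = y , y∈ , y-leads
  vector-in-A (pieceA _ _)       (there ())
  vector-in-A (pieceB _ _)       (here ≡.refl) ()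
  vector-in-A (pieceB _ _)       (there ())
  vector-in-A (pieceC _ _ _ _ _) (here ≡.refl) ()
  vector-in-A (pieceC _ _ _ _ _) (there (there ()))

  vector-in-A′ : ∀ {d} (P : Piece d) {p t S} → (p , t) ∈ kindRoles (kindOf P) → T (inA′ t) →
                 All (uncurry LeadsAt) (pieceEntries P) → All (λ u → InSpan u S) (a'Of P) →
                 ∃ λ u → InSpan u S × LeadsAt p u
  vector-in-A′ (pieceB _ x) (here ≡.refl) _ (x-leads ∷ []) (x∈ ∷ []) = x , x∈ , x-leads
  vector-in-A′ (pieceC _ _ i<j x y) (there (here ≡.refl)) _ (x-leads ∷ y-leads ∷ []) (x+y∈ ∷ []) =
    x +V y , x+y∈ , LeadsAt-+ i<j (proj₁ x-leads) y-leads
  vector-in-A′ (pieceA _ _)       (here ≡.refl) ()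
  vector-in-A′ (pieceA _ _)       (there ())
  vector-in-A′ (pieceB _ _)       (there ())
  vector-in-A′ (pieceC _ _ _ _ _) (here ≡.refl) ()
  vector-in-A′ (pieceC _ _ _ _ _) (there (there ()))

  vectors-of-C : ∀ {d} (P : Piece d) {i j S S′} → (i , roleCᵢ j) ∈ kindRoles (kindOf P) →
                 All (uncurry LeadsAt) (pieceEntries P) →
                 All (λ u → InSpan u S) (aOf P) → All (λ u → InSpan u S′) (a'Of P) →
                 ∃ λ x → ∃ λ y → LeadsAt i x × LeadsAt j y × InSpan y S × InSpan (x +V y) S′
  vectors-of-C (pieceC _ _ _ x y) (here ≡.refl) (x-leads ∷ y-leads ∷ []) (y∈ ∷ []) (x+y∈ ∷ []) =
    x , y , x-leads , y-leads , y∈ , x+y∈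
  vectors-of-C (pieceA _ _)       (here ())
  vectors-of-C (pieceA _ _)       (there ())
  vectors-of-C (pieceB _ _)       (here ())
  vectors-of-C (pieceB _ _)       (there ())
  vectors-of-C (pieceC _ _ _ _ _) (there (here ()))
  vectors-of-C (pieceC _ _ _ _ _) (there (there ()))

  module Decomposed (m n : ℕ) (g : Mat ((m ℕ.+ n) ℕ.+ (m ℕ.+ n)))
    (D : List (Piece ((m ℕ.+ n) ℕ.+ (m ℕ.+ n)))) (isD : IsDecomposition m n g D) where

    independent : LinIndep (vectors (entriesOf D))
    independent = ≡.subst LinIndep (vectors-entriesOf D) (proj₁ isD)

    levels : ∀ l → SameSpan (vectors (filterᵇ ((_≤ᵇ l) ∘ proj₁) (entriesOf D))) (flagVecs l)
    levels l = ≡.subst (λ L → SameSpan L (flagVecs l)) (levels-entriesOf l D) (proj₁ (proj₂ isD) l)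

    open Echelon (entriesOf D) independent levels using (leads; entries-unique; entries-total)

    roles-unique : Unique (map proj₁ (concatMap kindRoles (map kindOf D)))
    roles-unique = ≡.subst Unique (keys-entriesOf D) entries-unique

    roles-total : ∀ p → p ∈ map proj₁ (concatMap kindRoles (map kindOf D))
    roles-total p = ≡.subst (p ∈_) (keys-entriesOf D) (entries-total p)

    module K = KindShape (map kindOf D) roles-unique roles-total
    open K public using (role; shape; labelling-by)

    piece-at : ∀ p → ∃ λ P → P ∈ D × (p , role p) ∈ kindRoles (kindOf P)
    piece-at p =
      let κ , κ∈ , p∈κ = find (∈-concatMap⁻ kindRoles {xs = map kindOf D} (K.role-∈ p))
          P , P∈ , κ≡ = ∈-map⁻ kindOf κ∈
      in P , P∈ , ≡.subst (λ κ → (p , role p) ∈ kindRoles κ) κ≡ p∈κ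

    leads-in : ∀ {P} → P ∈ D → All (uncurry LeadsAt) (pieceEntries P)
    leads-in = All-concatMap-lookup pieceEntries leads

    A-spanned : ∀ {P} → P ∈ D → All (λ u → InSpan u (AVecs m n g)) (aOf P)
    A-spanned = All-concatMap-lookup aOf (AllInSpan⇒All (proj₁ (proj₁ (proj₂ (proj₂ isD)))))

    A′-spanned : ∀ {P} → P ∈ D → All (λ u → InSpan u (A'Vecs m n g)) (a'Of P)
    A′-spanned = All-concatMap-lookup a'Of (AllInSpan⇒All (proj₁ (proj₂ (proj₂ (proj₂ isD)))))

    vector-in-A-at : ∀ p → T (inA (role p)) → ∃ λ u → InSpan u (AVecs m n g) × LeadsAt p u
    vector-in-A-at p a =
      let P , P∈ , p∈P = piece-at p in
      vector-in-A P {S = AVecs m n g} p∈P a (leads-in P∈) (A-spanned P∈)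

    vector-in-A′-at : ∀ p → T (inA′ (role p)) → ∃ λ u → InSpan u (A'Vecs m n g) × LeadsAt p u
    vector-in-A′-at p a′ =
      let P , P∈ , p∈P = piece-at p in
      vector-in-A′ P {S = A'Vecs m n g} p∈P a′ (leads-in P∈) (A′-spanned P∈)

    vectors-of-C-at : ∀ {i j} → role i ≡ roleCᵢ j →
                      ∃ λ x → ∃ λ y → LeadsAt i x × LeadsAt j y ×
                                      InSpan y (AVecs m n g) × InSpan (x +V y) (A'Vecs m n g)
    vectors-of-C-at {i} eq =
      let P , P∈ , i∈P = piece-at i in
      vectors-of-C P {S = AVecs m n g} {S′ = A'Vecs m n g}
                   (≡.subst (λ t → (i , t) ∈ kindRoles (kindOf P)) eq i∈P)
                   (leads-in P∈) (A-spanned P∈) (A′-spanned P∈)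

  module Dual (m n : ℕ) (g φg : Mat ((m ℕ.+ n) ℕ.+ (m ℕ.+ n)))
    (preserves : ∀ v w → ⟪ m ℕ.+ n ⟫⟨ v , w ⟩ ≈ ⟪ m ℕ.+ n ⟫⟨ g · v , φg · w ⟩)
    (D : List (Piece ((m ℕ.+ n) ℕ.+ (m ℕ.+ n)))) (isD : IsDecomposition m n g D)
    (D′ : List (Piece ((m ℕ.+ n) ℕ.+ (m ℕ.+ n)))) (isD′ : IsDecomposition m n φg D′) where

    module 𝔇  = Decomposed m n g D isD
    module 𝔇′ = Decomposed m n φg D′ isD′
    open Form (m ℕ.+ n)
    open Orthogonality m n g φg preserves

    A⊥A′-roles : ∀ p → T (inA (𝔇.role p)) → ¬ T (inA′ (𝔇′.role (opposite p)))
    A⊥A′-roles p a a′ =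
      let u , u∈ , u-leads = 𝔇.vector-in-A-at p a
          w , w∈ , w-leads = 𝔇′.vector-in-A′-at (opposite p) a′
      in ⟨⟩-leads-opposite u-leads w-leads (A⊥A′ u∈ w∈)

    A′⊥A-roles : ∀ p → T (inA′ (𝔇.role p)) → ¬ T (inA (𝔇′.role (opposite p)))
    A′⊥A-roles p a′ a =
      let u , u∈ , u-leads = 𝔇.vector-in-A′-at p a′
          w , w∈ , w-leads = 𝔇′.vector-in-A-at (opposite p) a
      in ⟨⟩-leads-opposite u-leads w-leads (A′⊥A u∈ w∈)

    -- If q < -i, then y ⊥ x′ by ⟨⟩-cross, although they lead at opposite indices.
    Cᵢ-bound : ∀ {i j q} → 𝔇.role i ≡ roleCᵢ j → 𝔇′.role (opposite j) ≡ roleCᵢ q →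
               toℕ (opposite i) ℕ.≤ toℕ q
    Cᵢ-bound {i} {j} {q} i↦j j̄↦q = ℕₚ.≮⇒≥ λ q<ī →
      let x  , y  , x-leads  , y-leads  , y∈A  , x+y∈A′   = 𝔇.vectors-of-C-at i↦j
          x′ , y′ , x′-leads , y′-leads , y′∈A , x′+y′∈A′ = 𝔇′.vectors-of-C-at j̄↦q
          i<q̄ = ≡.subst (Fin._< opposite q) (Finₚ.opposite-involutive i) (opposite-< q<ī)
      in ⟨⟩-leads-opposite y-leads x′-leads
           (⟨⟩-cross x y x′ y′ (proj₁ x-leads) (proj₁ y′-leads) i<q̄
                     (A′⊥A x+y∈A′ y′∈A) (A⊥A′ y∈A x′+y′∈A′))

    role-dual : ∀ p → 𝔇′.role (opposite p) ≡ dual (𝔇.role p)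
    role-dual = Duality.role-dual 𝔇.shape 𝔇′.shape A⊥A′-roles A′⊥A-roles Cᵢ-bound

open import Data.Nat using (_+_)

proposition5p4 :
    ∀ {c ℓ : Level} (R : CommutativeRing c ℓ) → IsField R →
    ¬ (CommutativeRing._≈_ R (CommutativeRing._+_ R (CommutativeRing.1# R) (CommutativeRing.1# R)) (CommutativeRing.0# R)) →
    (m n : ℕ) →
    (g : LinAlg.Mat R ((m + n) + (m + n))) → LinAlg.Invertible R g →
    (φg : LinAlg.Mat R ((m + n) + (m + n))) →
    (∀ v w → CommutativeRing._≈_ R (LinAlg.⟪_⟫⟨_,_⟩ R (m + n) v w) (LinAlg.⟪_⟫⟨_,_⟩ R (m + n) (LinAlg._·_ R g v) (LinAlg._·_ R φg w))) →
    (D : List (LinAlg.Piece R ((m + n) + (m + n)))) → LinAlg.IsDecomposition R m n g D →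
    (D' : List (LinAlg.Piece R ((m + n) + (m + n)))) → LinAlg.IsDecomposition R m n φg D' →
    LinAlg.𝒮 R D' ↭ map negEdge (LinAlg.𝒮 R D)
proposition5p4 R isField _ m n g _ φg preserves D isD D′ isD′ = begin
  𝒮 D′                                                           ↭⟨ 𝔇′.labelling-by edgeᵢ edgeOf≡edgeᵢ ⟩
  concatMap (λ q → edgeᵢ q (𝔇′.role q)) (allFin _)                ↭⟨ labelling-dual 𝔇.role 𝔇′.role role-dual ⟩
  map negEdge (concatMap (λ p → edgeⱼ p (𝔇.role p)) (allFin _))   ↭⟨ map⁺ negEdge (↭-sym (𝔇.labelling-by edgeⱼ edgeOf≡edgeⱼ)) ⟩
  map negEdge (𝒮 D)                                              ∎
  where
  open LinAlg R using (𝒮)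
  open Pieces R isField
  open Dual m n g φg preserves D isD D′ isD′
  open PermutationReasoning
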